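{- Let $m\ge 4$ (so $S=\{2,m\}$ is admissible). In the expansion $p(\{2,m\};n)=\sum_{k\ge0}C^S_k\binom{n-m}{k}$ we have, for all $k\ge 0$, $$C^S_k=(m-3)\binom{m-2}{k-1}+(m-2)\binom{m-2}{k}-\binom{m-2}{k+m-3},$$ and $C^S_k\ge 0$ for all $k$.
   Context: For a permutation $\pi=a_1\ldots a_n$ of $\{1,\ldots,n\}$, an index $i$ is a peak if $a_{i-1}<a_i>a_{i+1}$. $P(S;n)$ is the set of permutations of $\{1,\dots,n\}$ whose set of peaks is exactly $S$. For an admissible finite set $S$, the peak polynomial $p(S;n)$ is the unique polynomial with $\#P(S;n)=p(S;n)2^{n-\#S-1}$ for all $n>\max S$. The coefficients $C^S_k$ are defined by $p(S;n)=\sum_{k\ge0}C^S_k\binom{n-m}{k}$ where $m=\max S$. Convention: $\binom{a}{b}=0$ if $b<0$ or $b>a$. -}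

module Defs where

open import Data.Nat using (ℕ; zero; suc; _∸_; _≤_; _<_; _<?_)
open import Data.Nat.Combinatorics using (_C_)
open import Data.Integer as ℤ using (ℤ; +_; -[1+_])
open import Data.Fin using (Fin; toℕ; fromℕ<)
open import Data.Vec using (Vec; lookup)
open import Data.List using (List; length)
open import Data.List.Membership.Propositional using (_∈_)
open import Data.List.Relation.Unary.Unique.Propositional using (Unique)
open import Data.Product using (Σ; ∃; _×_)
open import Relation.Binary.PropositionalEquality using (_≡_)
open import Relation.Nullary using (yes; no)
open import Function.Bundles using (_⇔_)

-- Binomial coefficient with integer lower index; (a choose b) = 0 if b < 0 or b > a.
chooseℤ : ℕ → ℤ → ℕ
chooseℤ a (+ b)     = a C b
chooseℤ a -[1+ _ ]  = 0

-- A permutation of {1,…,n} in one-line notation: a vector of length n with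
-- entries in Fin n (value v[i] represents a_{i+1} - 1), which is a bijection.
IsPermutation : {n : ℕ} → Vec (Fin n) n → Set
IsPermutation {n} v =
  (∀ (i j : Fin n) → lookup v i ≡ lookup v j → i ≡ j) ×
  (∀ (y : Fin n) → ∃ λ i → lookup v i ≡ y)

-- 1-based access: at v i = a_i - 1 for 1 ≤ i ≤ n (default 0 otherwise; only used in range).
at : {n : ℕ} → Vec (Fin n) n → ℕ → ℕ
at {n} v zero = 0
at {n} v (suc k) with k <? n
... | yes p = toℕ (lookup v (fromℕ< p))
... | no _  = 0

IsPeak : {n : ℕ} → Vec (Fin n) n → ℕ → Set
IsPeak {n} v i =
  2 ≤ i × i < n × at v (i ∸ 1) Data.Nat.< at v i × at v (suc i) Data.Nat.< at v i

HasPeakSet : {n : ℕ} → Vec (Fin n) n → List ℕ → Set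
HasPeakSet v S = ∀ i → IsPeak v i ⇔ (i ∈ S)

InP : (S : List ℕ) (n : ℕ) → Vec (Fin n) n → Set
InP S n v = IsPermutation v × HasPeakSet v S

HasCard : {A : Set} → (A → Set) → ℕ → Set
HasCard {A} P N = Σ (List A) λ L → Unique L × (∀ x → x ∈ L ⇔ P x) × length L ≡ N

sumTo : ℕ → (ℕ → ℤ) → ℤ
sumTo zero    f = f 0
sumTo (suc K) f = sumTo K f ℤ.+ f (suc K)

-- C : ℕ → ℤ are the coefficients of p(S;n) = Σ_k C_k binom(n-m, k), m = max S:
-- C is finitely supported (so Σ_k C_k binom(x,k) is a polynomial in x) and
-- for every n > m, #P(S;n) = 2^{n-#S-1} · Σ_k C_k binom(n-m,k)
-- (terms with k > n-m vanish, so the sum is truncated at k = n-m).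
IsPeakCoeffs : (S : List ℕ) (m : ℕ) (coef : ℕ → ℤ) → Set
IsPeakCoeffs S m coef =
  (∃ λ K → ∀ k → K < k → coef k ≡ + 0) ×
  (∀ n → m < n → ∃ λ N → HasCard (InP S n) N ×
     (+ N ≡ (+ (2 Data.Nat.^ (n ∸ length S ∸ 1))) ℤ.* sumTo (n ∸ m) (λ k → coef k ℤ.* + ((n ∸ m) C k))))

Cformula : ℕ → ℕ → ℤ
Cformula m k =
  + ((m ∸ 3) Data.Nat.* chooseℤ (m ∸ 2) (+ k ℤ.- + 1))
  ℤ.+ + ((m ∸ 2) Data.Nat.* chooseℤ (m ∸ 2) (+ k))
  ℤ.- + chooseℤ (m ∸ 2) (+ k ℤ.+ (+ m ℤ.- + 3))

-- Permutations of {0,…,n} arise uniquely by inserting the largest letter n into a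
-- permutation of {0,…,n-1}.  We record a permutation by its peak word (which positions are
-- peaks) and compute how an insertion changes it; this gives a recurrence for the number
-- peakCount n H of permutations with peak word H as a sum over the preimages of H.  Unfolding
-- it along the peak words with no peak, one peak, and two peaks at positions 2 and m gives
-- linear recurrences (noPeaks-double, onePeak-rec, twoPeaks-rec), solved by induction in
-- closed form: 2^a, 2^(s-1) (binom(s, a) - 1), and, for n = m + d and m = c + 3,
--   2^(c+d) (c binom(c+d+1, c+2) + (c+1) binom(c+d+1, c+1) - (c+d+1)).
-- Vandermonde's identity, used three times, rewrites the last expression as
-- 2^(n-3) Σ_k C_k binom(n-m, k).  Finally the permutation vectors of Defs with peak set {2, m}
-- are exactly those with the corresponding peak word, which provides the counting witness;
-- finiteness of the support and nonnegativity are read off from the formula for C_k.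
module Submission where

open import Defs
open import Function using (_∘_; id)
open import Function.Bundles using (_⇔_; mk⇔; Equivalence)
import Function.Properties.Equivalence as ⇔
open import Data.Empty using (⊥; ⊥-elim)
open import Data.Product using (∃; _×_; _,_; proj₁; proj₂)
open import Data.Sum using (_⊎_; inj₁; inj₂)
open import Relation.Nullary using (Dec; yes; no; does)
open import Relation.Binary.PropositionalEquality
open import Data.Bool using (Bool; true; false; _∧_)
import Data.Bool.Properties as BoolP
open import Data.Nat as ℕ using (ℕ; zero; suc; _+_; _*_; _^_; _<_; _≤_; _∸_; z≤n; s≤s; _<ᵇ_)
import Data.Nat.Properties as ℕP
open import Data.Nat.Combinatorics using (_C_; nCk+nC[k+1]≡[n+1]C[k+1])
open import Data.Nat.Tactic.RingSolver using (solve-∀)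
open import Data.Integer as ℤ using (ℤ; +_) renaming (_≤_ to _≤ℤ_)
import Data.Integer.Properties as ℤP
import Data.Integer.Tactic.RingSolver as ℤSolver
open import Data.Fin as Fin using (Fin; toℕ; fromℕ; fromℕ<; inject₁)
import Data.Fin.Properties as FinP
open import Data.Vec as Vec using (Vec; lookup)
open import Data.List as List using (List; []; _∷_; map; _++_; length; cartesianProductWith; upTo; applyUpTo; allFin; tabulate; filter)
import Data.List.Properties as ListP
open import Data.List.Relation.Unary.Any using (here; there)
open import Data.List.Relation.Unary.All as All using (All; []; _∷_)
open import Data.List.Relation.Unary.AllPairs using ([]; _∷_)
open import Data.List.Relation.Unary.Unique.Propositional using (Unique)
import Data.List.Relation.Unary.Unique.Propositional.Properties as Unique
open import Data.List.Relation.Binary.Disjoint.Propositional using (Disjoint)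
open import Data.List.Membership.Propositional using (_∈_; _∉_)
open import Data.List.Membership.Propositional.Properties
  using (∈-map⁺; ∈-map⁻; ∈-++⁺ˡ; ∈-++⁺ʳ; ∈-++⁻; ∈-∃++; ∈-cartesianProductWith⁺; ∈-cartesianProductWith⁻;
         ∈-upTo⁺; ∈-upTo⁻; ∈-filter⁺; ∈-filter⁻)

private
  variable
    A B D : Set

sumOver : List A → (A → ℕ) → ℕ
sumOver []       f = 0
sumOver (x ∷ xs) f = f x + sumOver xs f

sumOver-++ : (xs ys : List A) (f : A → ℕ) → sumOver (xs ++ ys) f ≡ sumOver xs f + sumOver ys f
sumOver-++ []       ys f = refl
sumOver-++ (x ∷ xs) ys f = trans (cong (_+_ (f x)) (sumOver-++ xs ys f)) (sym (ℕP.+-assoc (f x) _ _))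

sumOver-map : (g : A → B) (xs : List A) (f : B → ℕ) → sumOver (map g xs) f ≡ sumOver xs (f ∘ g)
sumOver-map g []       f = refl
sumOver-map g (x ∷ xs) f = cong (_+_ (f (g x))) (sumOver-map g xs f)

sumOver-cong : (xs : List A) {f g : A → ℕ} → (∀ x → x ∈ xs → f x ≡ g x) → sumOver xs f ≡ sumOver xs g
sumOver-cong []       e = refl
sumOver-cong (x ∷ xs) e = cong₂ _+_ (e x (here refl)) (sumOver-cong xs (λ y p → e y (there p)))

sumOver-+ : (xs : List A) (f g : A → ℕ) → sumOver xs (λ x → f x + g x) ≡ sumOver xs f + sumOver xs g
sumOver-+ []       f g = refl
sumOver-+ (x ∷ xs) f g = trans (cong (_+_ (f x + g x)) (sumOver-+ xs f g)) (interchange (f x) (g x) _ _)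
  where
  interchange : ∀ a b c d → a + b + (c + d) ≡ a + c + (b + d)
  interchange = solve-∀

sumOver-swap : (xs : List A) (ys : List B) (h : A → B → ℕ) →
  sumOver xs (λ x → sumOver ys (h x)) ≡ sumOver ys (λ y → sumOver xs (λ x → h x y))
sumOver-swap []       ys h = sym (sumOver-zero ys)
  where
  sumOver-zero : (ys : List B) → sumOver ys (λ _ → 0) ≡ 0
  sumOver-zero []       = refl
  sumOver-zero (y ∷ ys) = sumOver-zero ys
sumOver-swap (x ∷ xs) ys h =
  trans (cong (_+_ (sumOver ys (h x))) (sumOver-swap xs ys h)) (sym (sumOver-+ ys (h x) _))

sumOver-cartesianProductWith : (f : A → B → D) (xs : List A) (ys : List B) (h : D → ℕ) →
  sumOver (cartesianProductWith f xs ys) h ≡ sumOver xs (λ x → sumOver ys (λ y → h (f x y)))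
sumOver-cartesianProductWith f []       ys h = refl
sumOver-cartesianProductWith f (x ∷ xs) ys h =
  trans (sumOver-++ (map (f x) ys) _ h)
        (cong₂ _+_ (sumOver-map (f x) ys h) (sumOver-cartesianProductWith f xs ys h))

upTo-suc : ∀ n → upTo (suc n) ≡ 0 ∷ map suc (upTo n)
upTo-suc n = cong (0 ∷_) (sym (ListP.map-applyUpTo id suc n))

-- The library
-- versions require injectivity everywhere, but insertion is only injective on the words it is
-- applied to (a fresh letter at a valid position).
unique-map-on : (f : A → B) {xs : List A} →
  (∀ {x y} → x ∈ xs → y ∈ xs → f x ≡ f y → x ≡ y) → Unique xs → Unique (map f xs)
unique-map-on f {[]}     inj []         = []
unique-map-on f {x ∷ xs} inj (x∉ ∷ uxs) =
  All.tabulate fresh ∷ unique-map-on f (λ p q → inj (there p) (there q)) uxs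
  where
  fresh : ∀ {z} → z ∈ map f xs → f x ≢ z
  fresh z∈ eq with ∈-map⁻ f z∈
  ... | y , y∈ , refl = All.lookup x∉ y∈ (inj (here refl) (there y∈) eq)

unique-cartesianProductWith-on : (f : A → B → D) {xs : List A} {ys : List B} →
  (∀ {a c b d} → a ∈ xs → c ∈ xs → b ∈ ys → d ∈ ys → f a b ≡ f c d → a ≡ c × b ≡ d) →
  Unique xs → Unique ys → Unique (cartesianProductWith f xs ys)
unique-cartesianProductWith-on f {[]}     inj _          _   = []
unique-cartesianProductWith-on f {x ∷ xs} {ys} inj (x∉ ∷ uxs) uys =
  Unique.++⁺ (unique-map-on (f x) (λ p q e → proj₂ (inj (here refl) (here refl) p q e)) uys)
             (unique-cartesianProductWith-on f (λ p q → inj (there p) (there q)) uxs uys)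
             disjoint
  where
  disjoint : Disjoint (map (f x) ys) (cartesianProductWith f xs ys)
  disjoint (p , q) with ∈-map⁻ (f x) p | ∈-cartesianProductWith⁻ f xs ys q
  ... | b , b∈ , refl | c , d , c∈ , d∈ , eq =
    All.lookup x∉ c∈ (proj₁ (inj (here refl) (there c∈) b∈ d∈ eq))

-- Every such word arises uniquely by inserting the largest letter n-1
-- into a permutation word of length n-1, which gives the enumeration permWords.
IsPermWord : ℕ → List ℕ → Set
IsPermWord n w = length w ≡ n × (∀ x → x ∈ w → x < n) × (∀ y → y < n → y ∈ w) × Unique w

-- insertAt w j x puts x in front of the j-th letter of w (at the end if j ≥ length w).
insertAt : List ℕ → ℕ → ℕ → List ℕ
insertAt w       zero    x = x ∷ w
insertAt []      (suc j) x = x ∷ []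
insertAt (a ∷ w) (suc j) x = a ∷ insertAt w j x

permWords : ℕ → List (List ℕ)
permWords zero    = [] ∷ []
permWords (suc n) = cartesianProductWith (λ w j → insertAt w j n) (permWords n) (upTo (suc n))

∈-insertAt⁻ : ∀ {z} w j x → z ∈ insertAt w j x → z ≡ x ⊎ z ∈ w
∈-insertAt⁻ w       zero    x (here p)  = inj₁ p
∈-insertAt⁻ w       zero    x (there p) = inj₂ p
∈-insertAt⁻ []      (suc j) x (here p)  = inj₁ p
∈-insertAt⁻ (a ∷ w) (suc j) x (here p)  = inj₂ (here p)
∈-insertAt⁻ (a ∷ w) (suc j) x (there p) with ∈-insertAt⁻ w j x p
... | inj₁ q = inj₁ q
... | inj₂ q = inj₂ (there q)

∈-insertAt-new : ∀ w j x → x ∈ insertAt w j x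
∈-insertAt-new w       zero    x = here refl
∈-insertAt-new []      (suc j) x = here refl
∈-insertAt-new (a ∷ w) (suc j) x = there (∈-insertAt-new w j x)

∈-insertAt-old : ∀ {z} w j x → z ∈ w → z ∈ insertAt w j x
∈-insertAt-old w       zero    x p         = there p
∈-insertAt-old (a ∷ w) (suc j) x (here p)  = here p
∈-insertAt-old (a ∷ w) (suc j) x (there p) = there (∈-insertAt-old w j x p)

length-insertAt : ∀ w j x → j ≤ length w → length (insertAt w j x) ≡ suc (length w)
length-insertAt w       zero    x _         = refl
length-insertAt (a ∷ w) (suc j) x (s≤s j≤) = cong suc (length-insertAt w j x j≤)

unique-insertAt : ∀ w j x → x ∉ w → Unique w → Unique (insertAt w j x)
unique-insertAt w       zero    x x∉ uw = All.tabulate (λ z∈ x≡z → x∉ (subst (_∈ w) (sym x≡z) z∈)) ∷ uw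
unique-insertAt []      (suc j) x x∉ uw = [] ∷ []
unique-insertAt (a ∷ w) (suc j) x x∉ (a∉ ∷ uw) =
  All.tabulate fresh ∷ unique-insertAt w j x (x∉ ∘ there) uw
  where
  fresh : ∀ {z} → z ∈ insertAt w j x → a ≢ z
  fresh z∈ a≡z with ∈-insertAt⁻ w j x z∈
  ... | inj₁ refl = x∉ (here (sym a≡z))
  ... | inj₂ q    = All.lookup a∉ q a≡z

-- The position of a fresh letter determines both the position and the remaining word.
insertAt-injective : ∀ {x} w w′ j j′ → x ∉ w → x ∉ w′ → j ≤ length w → j′ ≤ length w′ →
  insertAt w j x ≡ insertAt w′ j′ x → w ≡ w′ × j ≡ j′
insertAt-injective w        w′         zero    zero     _  _   _        _         refl = refl , refl
insertAt-injective w        (a ∷ w′)   zero    (suc j′) _  x∉′ _        _         refl = ⊥-elim (x∉′ (here refl))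
insertAt-injective (a ∷ w)  w′         (suc j) zero     x∉ _   _        _         refl = ⊥-elim (x∉ (here refl))
insertAt-injective (a ∷ w)  (a′ ∷ w′)  (suc j) (suc j′) x∉ x∉′ (s≤s j≤) (s≤s j′≤) eq
  with refl , eq′ ← ListP.∷-injective eq
  with refl , refl ← insertAt-injective w w′ j j′ (x∉ ∘ there) (x∉′ ∘ there) j≤ j′≤ eq′ = refl , refl

insertAt-split : ∀ (u : List ℕ) x v → insertAt (u ++ v) (length u) x ≡ u ++ x ∷ v
insertAt-split []      x v = refl
insertAt-split (a ∷ u) x v = cong (a ∷_) (insertAt-split u x v)

insertion-valid : ∀ {n w j} → IsPermWord n w → j ∈ upTo (suc n) → j ≤ length w × n ∉ w
insertion-valid {n} (len , bounded , _ , _) j∈ =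
  subst (_ ≤_) (sym len) (ℕP.≤-pred (∈-upTo⁻ j∈)) , λ n∈ → ℕP.<-irrefl refl (bounded n n∈)

permWords-sound : ∀ n w → w ∈ permWords n → IsPermWord n w
permWords-sound zero    w (here refl) = refl , (λ _ ()) , (λ _ ()) , []
permWords-sound (suc n) w w∈
  with w′ , j , w′∈ , j∈ , refl ← ∈-cartesianProductWith⁻ (λ w j → insertAt w j n) (permWords n) (upTo (suc n)) w∈
  with good@(len , bounded , covers , uw′) ← permWords-sound n w′ w′∈
  with j≤ , n∉ ← insertion-valid good j∈ =
  trans (length-insertAt w′ j n j≤) (cong suc len) , bounded′ , covers′ , unique-insertAt w′ j n n∉ uw′
  where
  bounded′ : ∀ x → x ∈ insertAt w′ j n → x < suc n
  bounded′ x x∈ with ∈-insertAt⁻ w′ j n x∈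
  ... | inj₁ refl = ℕP.≤-refl
  ... | inj₂ q    = ℕP.m≤n⇒m≤1+n (bounded x q)
  covers′ : ∀ y → y < suc n → y ∈ insertAt w′ j n
  covers′ y (s≤s y≤n) with ℕP.m≤n⇒m<n∨m≡n y≤n
  ... | inj₁ y<n  = ∈-insertAt-old w′ j n (covers y y<n)
  ... | inj₂ refl = ∈-insertAt-new w′ j n

∈-middle⁺ : ∀ (u : List A) {x v y} → y ∈ u ++ v → y ∈ u ++ x ∷ v
∈-middle⁺ u y∈ with ∈-++⁻ u y∈
... | inj₁ p = ∈-++⁺ˡ p
... | inj₂ q = ∈-++⁺ʳ u (there q)

unique-removeMiddle : ∀ (u : List A) {x v} → Unique (u ++ x ∷ v) → Unique (u ++ v) × x ∉ u ++ v
unique-removeMiddle []      (x∉ ∷ uv) = uv , λ x∈ → All.lookup x∉ x∈ refl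
unique-removeMiddle (a ∷ u) {x} {v} (a∉ ∷ uw)
  with uv , x∉ ← unique-removeMiddle u uw =
  All.tabulate (All.lookup a∉ ∘ ∈-middle⁺ u) ∷ uv , x∉′
  where
  x∉′ : x ∉ a ∷ u ++ v
  x∉′ (here refl) = All.lookup a∉ (∈-++⁺ʳ u (here refl)) refl
  x∉′ (there q)   = x∉ q

deleteMax : ∀ {n} u v → IsPermWord (suc n) (u ++ n ∷ v) → IsPermWord n (u ++ v)
deleteMax {n} u v (len , bounded , covers , uw)
  with uuv , n∉ ← unique-removeMiddle u uw =
  ℕP.suc-injective (trans (sym lengths) len) , bounded′ , covers′ , uuv
  where
  lengths : length (u ++ n ∷ v) ≡ suc (length (u ++ v))
  lengths = trans (ListP.length-++ u) (trans (ℕP.+-suc (length u) (length v)) (cong suc (sym (ListP.length-++ u))))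
  bounded′ : ∀ x → x ∈ u ++ v → x < n
  bounded′ x x∈ with ℕP.m≤n⇒m<n∨m≡n (ℕP.≤-pred (bounded x (∈-middle⁺ u x∈)))
  ... | inj₁ x<n  = x<n
  ... | inj₂ refl = ⊥-elim (n∉ x∈)
  covers′ : ∀ y → y < n → y ∈ u ++ v
  covers′ y y<n with ∈-++⁻ u (covers y (ℕP.m≤n⇒m≤1+n y<n))
  ... | inj₁ p           = ∈-++⁺ˡ p
  ... | inj₂ (here refl) = ⊥-elim (ℕP.<-irrefl refl y<n)
  ... | inj₂ (there q)   = ∈-++⁺ʳ u q

permWords-complete : ∀ n w → IsPermWord n w → w ∈ permWords n
permWords-complete zero    []      _         = here refl
permWords-complete (suc n) w good@(len , _ , covers , _)
  with u , v , refl ← ∈-∃++ (covers n ℕP.≤-refl)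
  with good′@(len′ , _) ← deleteMax u v good =
  subst (_∈ permWords (suc n)) (insertAt-split u n v)
    (∈-cartesianProductWith⁺ (λ w j → insertAt w j n)
      (permWords-complete n (u ++ v) good′) (∈-upTo⁺ (s≤s u≤n)))
  where
  u≤n : length u ≤ n
  u≤n = subst (length u ≤_) len′ (subst (length u ≤_) (sym (ListP.length-++ u)) (ℕP.m≤m+n (length u) (length v)))

permWords-unique : ∀ n → Unique (permWords n)
permWords-unique zero    = [] ∷ []
permWords-unique (suc n) =
  unique-cartesianProductWith-on (λ w j → insertAt w j n) injective
    (permWords-unique n) (Unique.upTo⁺ (suc n))
  where
  injective : ∀ {a c b d} → a ∈ permWords n → c ∈ permWords n → b ∈ upTo (suc n) → d ∈ upTo (suc n) →
    insertAt a b n ≡ insertAt c d n → a ≡ c × b ≡ d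
  injective {a} {c} {b} {d} a∈ c∈ b∈ d∈
    with b≤ , n∉a ← insertion-valid (permWords-sound n a a∈) b∈
    with d≤ , n∉c ← insertion-valid (permWords-sound n c c∈) d∈ =
    insertAt-injective a c b d n∉a n∉c b≤ d≤

-- Permutation vectors (the form used in Defs) are enumerated by the same insertion scheme;
-- reading off letters with wordOf turns this enumeration into permWords.
wordOf : {k m : ℕ} → Vec (Fin k) m → List ℕ
wordOf v = Vec.toList (Vec.map toℕ v)

insertMaxVec : ∀ {n} → Vec (Fin n) n → Fin (suc n) → Vec (Fin (suc n)) (suc n)
insertMaxVec {n} v i = Vec.insertAt (Vec.map inject₁ v) i (fromℕ n)

permVecs : (n : ℕ) → List (Vec (Fin n) n)
permVecs zero    = Vec.[] ∷ []
permVecs (suc n) = cartesianProductWith insertMaxVec (permVecs n) (allFin (suc n))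

wordOf-insertAt : ∀ {k m} (v : Vec (Fin k) m) i y →
  wordOf (Vec.insertAt v i y) ≡ insertAt (wordOf v) (toℕ i) (toℕ y)
wordOf-insertAt v         Fin.zero    y = refl
wordOf-insertAt (a Vec.∷ v) (Fin.suc i) y = cong (toℕ a ∷_) (wordOf-insertAt v i y)

wordOf-inject₁ : ∀ {k m} (v : Vec (Fin k) m) → wordOf (Vec.map inject₁ v) ≡ wordOf v
wordOf-inject₁ Vec.[]       = refl
wordOf-inject₁ (a Vec.∷ v) = cong₂ _∷_ (FinP.toℕ-inject₁ a) (wordOf-inject₁ v)

wordOf-insertMaxVec : ∀ {n} (v : Vec (Fin n) n) i → wordOf (insertMaxVec v i) ≡ insertAt (wordOf v) (toℕ i) n
wordOf-insertMaxVec {n} v i =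
  trans (wordOf-insertAt (Vec.map inject₁ v) i (fromℕ n))
        (cong₂ (λ w x → insertAt w (toℕ i) x) (wordOf-inject₁ v) (FinP.toℕ-fromℕ n))

map-cartesianProductWith : (f : A → B → D) {A′ B′ D′ : Set} (g : A′ → B′ → D′) (h : D → D′) (a : A → A′) (b : B → B′) →
  (∀ x y → h (f x y) ≡ g (a x) (b y)) → ∀ xs ys →
  map h (cartesianProductWith f xs ys) ≡ cartesianProductWith g (map a xs) (map b ys)
map-cartesianProductWith f g h a b e []       ys = refl
map-cartesianProductWith f g h a b e (x ∷ xs) ys =
  trans (ListP.map-++ h (map (f x) ys) (cartesianProductWith f xs ys))
    (cong₂ _++_ (trans (sym (ListP.map-∘ ys)) (trans (ListP.map-cong (e x) ys) (ListP.map-∘ ys)))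
                (map-cartesianProductWith f g h a b e xs ys))

map-toℕ-allFin : ∀ n → map toℕ (allFin n) ≡ upTo n
map-toℕ-allFin n = trans (ListP.map-tabulate id toℕ) (tabulate-applyUpTo n id)
  where
  tabulate-applyUpTo : ∀ n (f : ℕ → ℕ) → tabulate {n = n} (f ∘ toℕ) ≡ applyUpTo f n
  tabulate-applyUpTo zero    f = refl
  tabulate-applyUpTo (suc n) f = cong (f 0 ∷_) (tabulate-applyUpTo n (f ∘ suc))

map-wordOf-permVecs : ∀ n → map wordOf (permVecs n) ≡ permWords n
map-wordOf-permVecs zero    = refl
map-wordOf-permVecs (suc n) =
  trans (map-cartesianProductWith insertMaxVec (λ w j → insertAt w j n) wordOf wordOf toℕ
           wordOf-insertMaxVec (permVecs n) (allFin (suc n)))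
        (cong₂ (cartesianProductWith (λ w j → insertAt w j n)) (map-wordOf-permVecs n) (map-toℕ-allFin (suc n)))

wordOf-injective : ∀ {k m} (u v : Vec (Fin k) m) → wordOf u ≡ wordOf v → u ≡ v
wordOf-injective Vec.[]       Vec.[]       _ = refl
wordOf-injective (a Vec.∷ u) (b Vec.∷ v) e with e₁ , e₂ ← ListP.∷-injective e =
  cong₂ Vec._∷_ (FinP.toℕ-injective e₁) (wordOf-injective u v e₂)

permVecs-unique : ∀ n → Unique (permVecs n)
permVecs-unique n = Unique.map⁻ (subst Unique (sym (map-wordOf-permVecs n)) (permWords-unique n))

lookup∈wordOf : ∀ {k m} (v : Vec (Fin k) m) i → toℕ (lookup v i) ∈ wordOf v
lookup∈wordOf (a Vec.∷ v) Fin.zero    = here refl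
lookup∈wordOf (a Vec.∷ v) (Fin.suc i) = there (lookup∈wordOf v i)

∈wordOf⁻ : ∀ {k m} (v : Vec (Fin k) m) {x} → x ∈ wordOf v → ∃ λ i → toℕ (lookup v i) ≡ x
∈wordOf⁻ (a Vec.∷ v) (here refl) = Fin.zero , refl
∈wordOf⁻ (a Vec.∷ v) (there p) with i , e ← ∈wordOf⁻ v p = Fin.suc i , e

length-wordOf : ∀ {k m} (v : Vec (Fin k) m) → length (wordOf v) ≡ m
length-wordOf Vec.[]       = refl
length-wordOf (a Vec.∷ v) = cong suc (length-wordOf v)

isPermutation⇒permWord : ∀ {n} (v : Vec (Fin n) n) → IsPermutation v → IsPermWord n (wordOf v)
isPermutation⇒permWord {n} v (injective , surjective) =
  length-wordOf v , bounded , covers , unique v injective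
  where
  bounded : ∀ x → x ∈ wordOf v → x < n
  bounded x x∈ with i , refl ← ∈wordOf⁻ v x∈ = FinP.toℕ<n (lookup v i)
  covers : ∀ y → y < n → y ∈ wordOf v
  covers y y<n with i , e ← surjective (fromℕ< y<n) =
    subst (_∈ wordOf v) (trans (cong toℕ e) (FinP.toℕ-fromℕ< y<n)) (lookup∈wordOf v i)
  unique : ∀ {k m} (v : Vec (Fin k) m) → (∀ i j → lookup v i ≡ lookup v j → i ≡ j) → Unique (wordOf v)
  unique Vec.[]       _   = []
  unique (a Vec.∷ v) inj = All.tabulate fresh ∷ unique v (λ i j e → FinP.suc-injective (inj (Fin.suc i) (Fin.suc j) e))
    where
    fresh : ∀ {z} → z ∈ wordOf v → toℕ a ≢ z
    fresh z∈ a≡z with j , e ← ∈wordOf⁻ v z∈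
      with () ← inj Fin.zero (Fin.suc j) (FinP.toℕ-injective (trans a≡z (sym e)))

permWord⇒isPermutation : ∀ {n} (v : Vec (Fin n) n) → IsPermWord n (wordOf v) → IsPermutation v
permWord⇒isPermutation {n} v (_ , _ , covers , uv) = injective v uv , surjective
  where
  injective : ∀ {k m} (v : Vec (Fin k) m) → Unique (wordOf v) → ∀ i j → lookup v i ≡ lookup v j → i ≡ j
  injective (a Vec.∷ v) _          Fin.zero    Fin.zero    _ = refl
  injective (a Vec.∷ v) (a∉ ∷ _)   Fin.zero    (Fin.suc j) e = ⊥-elim (All.lookup a∉ (lookup∈wordOf v j) (cong toℕ e))
  injective (a Vec.∷ v) (a∉ ∷ _)   (Fin.suc i) Fin.zero    e = ⊥-elim (All.lookup a∉ (lookup∈wordOf v i) (cong toℕ (sym e)))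
  injective (a Vec.∷ v) (_ ∷ uv)   (Fin.suc i) (Fin.suc j) e = cong Fin.suc (injective v uv i j e)
  surjective : ∀ y → ∃ λ i → lookup v i ≡ y
  surjective y with i , e ← ∈wordOf⁻ v (covers (toℕ y) (FinP.toℕ<n y)) = i , FinP.toℕ-injective e

permVecs-sound : ∀ n v → v ∈ permVecs n → IsPermutation v
permVecs-sound n v v∈ = permWord⇒isPermutation v
  (permWords-sound n (wordOf v) (subst (wordOf v ∈_) (map-wordOf-permVecs n) (∈-map⁺ wordOf v∈)))

permVecs-complete : ∀ n v → IsPermutation v → v ∈ permVecs n
permVecs-complete n v perm
  with v′ , v′∈ , e ← ∈-map⁻ wordOf (subst (wordOf v ∈_) (sym (map-wordOf-permVecs n))
                                       (permWords-complete n (wordOf v) (isPermutation⇒permWord v perm))) =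
  subst (_∈ permVecs n) (sym (wordOf-injective v v′ e)) v′∈

-- The peak word of w = w₀ w₁ … w_{n-1} is the list of booleans whose q-th entry
-- says whether position q is a peak (w_{q-1} < w_q > w_{q+1}); peakFlags a r is the peak word
-- of the suffix r when its left neighbour is a.
isPeakBetween : ℕ → ℕ → List ℕ → Bool
isPeakBetween a b []      = false
isPeakBetween a b (c ∷ _) = (a <ᵇ b) ∧ (c <ᵇ b)

peakFlags : ℕ → List ℕ → List Bool
peakFlags a []      = []
peakFlags a (b ∷ r) = isPeakBetween a b r ∷ peakFlags b r

peakWord : List ℕ → List Bool
peakWord []      = []
peakWord (a ∷ r) = false ∷ peakFlags a r

<ᵇ-true : ∀ {a b} → a < b → (a <ᵇ b) ≡ true
<ᵇ-true a<b = Equivalence.to BoolP.T-≡ (ℕP.<⇒<ᵇ a<b)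

<ᵇ-sound : ∀ {a b} → (a <ᵇ b) ≡ true → a < b
<ᵇ-sound {a} {b} e = ℕP.<ᵇ⇒< a b (Equivalence.from BoolP.T-≡ e)

<ᵇ-false : ∀ {a b} → b < a → (a <ᵇ b) ≡ false
<ᵇ-false {a} {b} b<a with a <ᵇ b in eq
... | false = refl
... | true  = ⊥-elim (ℕP.<-asym b<a (<ᵇ-sound eq))

∧-true⁻ : ∀ {x y} → (x ∧ y) ≡ true → x ≡ true × y ≡ true
∧-true⁻ {true} {true} _ = refl , refl

-- Effect of inserting a new maximum on peak words: at the front (insertPeak B 0) nothing
-- changes, elsewhere the new letter becomes a peak (unless it is last) and its two
-- neighbours stop being peaks.  insertPeakAfter describes this on peakFlags.
insertPeakAfter : List Bool → ℕ → List Bool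
insertPeakAfter []      zero          = false ∷ []
insertPeakAfter (g ∷ G) zero          = true ∷ false ∷ G
insertPeakAfter []      (suc j)       = []
insertPeakAfter (g ∷ G) (suc zero)    = false ∷ insertPeakAfter G zero
insertPeakAfter (g ∷ G) (suc (suc j)) = g ∷ insertPeakAfter G (suc j)

insertPeak : List Bool → ℕ → List Bool
insertPeak B       zero    = false ∷ B
insertPeak []      (suc j) = []
insertPeak (e ∷ G) (suc j) = e ∷ insertPeakAfter G j

peakFlags-below : ∀ x w → All (_< x) w → peakFlags x w ≡ peakWord w
peakFlags-below x []          _          = refl
peakFlags-below x (b ∷ [])    _          = refl
peakFlags-below x (b ∷ c ∷ r) (b<x ∷ _) rewrite <ᵇ-false b<x = refl

peakFlags-insertAt : ∀ a r j x → j ≤ length r → a < x → All (_< x) r →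
  peakFlags a (insertAt r j x) ≡ insertPeakAfter (peakFlags a r) j
peakFlags-insertAt a []       zero x _ a<x _ = refl
peakFlags-insertAt a (b ∷ r) zero x _ a<x (b<x ∷ _)
  rewrite <ᵇ-true a<x | <ᵇ-true b<x = cong (λ z → true ∷ z ∷ peakFlags b r) (not-peak r)
  where
  not-peak : ∀ r → isPeakBetween x b r ≡ false
  not-peak []      = refl
  not-peak (c ∷ _) rewrite <ᵇ-false b<x = refl
peakFlags-insertAt a (b ∷ r) (suc zero) x _ a<x (b<x ∷ r<x)
  rewrite <ᵇ-false b<x | BoolP.∧-zeroʳ (a <ᵇ b) = cong (false ∷_) (peakFlags-insertAt b r zero x z≤n b<x r<x)
peakFlags-insertAt a (b ∷ c ∷ r) (suc (suc j)) x (s≤s j≤) a<x (b<x ∷ r<x) =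
  cong (isPeakBetween a b (c ∷ r) ∷_) (peakFlags-insertAt b (c ∷ r) (suc j) x j≤ b<x r<x)

peakWord-insertAt : ∀ w j x → j ≤ length w → All (_< x) w → peakWord (insertAt w j x) ≡ insertPeak (peakWord w) j
peakWord-insertAt w       zero    x _         w<x         = cong (false ∷_) (peakFlags-below x w w<x)
peakWord-insertAt (a ∷ r) (suc j) x (s≤s j≤) (a<x ∷ r<x) = cong (false ∷_) (peakFlags-insertAt a r j x j≤ a<x r<x)

peakWord-first : ∀ w Y → peakWord w ≢ true ∷ Y
peakWord-first (a ∷ r) Y ()

peakFlags-adjacent : ∀ a r X Y → peakFlags a r ≢ X ++ true ∷ true ∷ Y
peakFlags-adjacent a (b ∷ c ∷ []) [] Y e with () ← ListP.∷-injectiveˡ (ListP.∷-injectiveʳ e)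
peakFlags-adjacent a (b ∷ c ∷ d ∷ r) [] Y e
  with e₁ , e₂ ← ListP.∷-injective e
  with e₃ , _ ← ListP.∷-injective e₂ =
  ℕP.<-asym (<ᵇ-sound {c} {b} (proj₂ (∧-true⁻ {a <ᵇ b} e₁))) (<ᵇ-sound {b} {c} (proj₁ (∧-true⁻ {b <ᵇ c} e₃)))
peakFlags-adjacent a (b ∷ r) (_ ∷ X) Y e = peakFlags-adjacent b r X Y (ListP.∷-injectiveʳ e)

peakWord-adjacent : ∀ w X Y → peakWord w ≢ X ++ true ∷ true ∷ Y
peakWord-adjacent (a ∷ r) []      Y ()
peakWord-adjacent (a ∷ r) (_ ∷ X) Y e = peakFlags-adjacent a r X Y (ListP.∷-injectiveʳ e)

peakFlags-last : ∀ a r X → peakFlags a r ≢ X ++ true ∷ []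
peakFlags-last a (b ∷ [])    []      ()
peakFlags-last a (b ∷ c ∷ r) []      e with () ← ListP.∷-injectiveʳ e
peakFlags-last a (b ∷ r)     (_ ∷ X) e = peakFlags-last b r X (ListP.∷-injectiveʳ e)

peakWord-last : ∀ w X → peakWord w ≢ X ++ true ∷ []
peakWord-last (a ∷ r) []      ()
peakWord-last (a ∷ r) (_ ∷ X) e = peakFlags-last a r X (ListP.∷-injectiveʳ e)

-- The q-th letter of a word (0 past the end) and the q-th flag of a peak word (false past the end).
nth : List ℕ → ℕ → ℕ
nth []      _       = 0
nth (a ∷ r) zero    = a
nth (a ∷ r) (suc k) = nth r k

flagAt : List Bool → ℕ → Bool
flagAt []      _       = false
flagAt (a ∷ r) zero    = a
flagAt (a ∷ r) (suc k) = flagAt r k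

-- Flag q of peakFlags a r is set exactly when the (q+1)-st letter of a ∷ r is an interior peak.
IsPeakAt : List ℕ → ℕ → Set
IsPeakAt w q = suc (suc q) < length w × nth w q < nth w (suc q) × nth w (suc (suc q)) < nth w (suc q)

peakFlags-flag⇒ : ∀ a r q → flagAt (peakFlags a r) q ≡ true → IsPeakAt (a ∷ r) q
peakFlags-flag⇒ a (b ∷ c ∷ r) zero    e with a<b , c<b ← ∧-true⁻ e = s≤s (s≤s (s≤s z≤n)) , <ᵇ-sound a<b , <ᵇ-sound c<b
peakFlags-flag⇒ a (b ∷ r)     (suc q) e with len , l , r′ ← peakFlags-flag⇒ b r q e = s≤s len , l , r′

peakFlags-flag⇐ : ∀ a r q → IsPeakAt (a ∷ r) q → flagAt (peakFlags a r) q ≡ true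
peakFlags-flag⇐ a (b ∷ [])    zero    (s≤s (s≤s ()) , _)
peakFlags-flag⇐ a (b ∷ c ∷ r) zero    (_ , a<b , c<b) rewrite <ᵇ-true a<b | <ᵇ-true c<b = refl
peakFlags-flag⇐ a (b ∷ r)     (suc q) (s≤s len , l , r′) = peakFlags-flag⇐ b r q (len , l , r′)

peakWord-flag⇔ : ∀ w q → flagAt (peakWord w) (suc q) ≡ true ⇔ IsPeakAt w q
peakWord-flag⇔ []      q = mk⇔ (λ ()) (λ ())
peakWord-flag⇔ (a ∷ r) q = mk⇔ (peakFlags-flag⇒ a r q) (peakFlags-flag⇐ a r q)

peakWord-flag₀ : ∀ w → flagAt (peakWord w) 0 ≢ true
peakWord-flag₀ []      ()
peakWord-flag₀ (a ∷ r) ()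

at-nth : ∀ {n} (v : Vec (Fin n) n) k → at v (suc k) ≡ nth (wordOf v) k
at-nth {n} v k with k ℕ.<? n
... | yes k<n = lookup-nth v k<n
  where
  lookup-nth : ∀ {k m} (v : Vec (Fin k) m) {j} (j<m : j < m) → toℕ (lookup v (fromℕ< j<m)) ≡ nth (wordOf v) j
  lookup-nth (a Vec.∷ v) {zero}  _         = refl
  lookup-nth (a Vec.∷ v) {suc j} (s≤s j<m) = lookup-nth v j<m
... | no k≮n = sym (nth-past-end (wordOf v) k (subst (_≤ k) (sym (length-wordOf v)) (ℕP.≮⇒≥ k≮n)))
  where
  nth-past-end : ∀ w k → length w ≤ k → nth w k ≡ 0
  nth-past-end []      k       _         = refl
  nth-past-end (a ∷ w) (suc k) (s≤s len) = nth-past-end w k len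

isPeak⇔flag : ∀ {n} (v : Vec (Fin n) n) i → IsPeak v i ⇔ (flagAt (peakWord (wordOf v)) (i ∸ 1) ≡ true)
isPeak⇔flag v zero          = mk⇔ (λ ()) (⊥-elim ∘ peakWord-flag₀ (wordOf v))
isPeak⇔flag v (suc zero)    = mk⇔ (λ { (s≤s () , _) }) (⊥-elim ∘ peakWord-flag₀ (wordOf v))
isPeak⇔flag v (suc (suc q)) =
  mk⇔ (Equivalence.from (peakWord-flag⇔ w q) ∘ to) (from ∘ Equivalence.to (peakWord-flag⇔ w q))
  where
  w = wordOf v
  e₀ = at-nth v q
  e₁ = at-nth v (suc q)
  e₂ = at-nth v (suc (suc q))
  to : IsPeak v (suc (suc q)) → IsPeakAt w q
  to (_ , i<n , l , r) = subst (suc (suc q) <_) (sym (length-wordOf v)) i<n , subst₂ _<_ e₀ e₁ l , subst₂ _<_ e₂ e₁ r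
  from : IsPeakAt w q → IsPeak v (suc (suc q))
  from (i<n , l , r) = s≤s (s≤s z≤n) , subst (suc (suc q) <_) (length-wordOf v) i<n ,
                       subst₂ _<_ (sym e₀) (sym e₁) l , subst₂ _<_ (sym e₂) (sym e₁) r

_≟ʷ_ : (G H : List Bool) → Dec (G ≡ H)
_≟ʷ_ = ListP.≡-dec BoolP._≟_

indicator : Bool → ℕ
indicator true  = 1
indicator false = 0

indicator-∧ : ∀ a b → indicator (a ∧ b) ≡ indicator a * indicator b
indicator-∧ true  b = sym (ℕP.+-identityʳ (indicator b))
indicator-∧ false b = refl

peakCount : ℕ → List Bool → ℕ
peakCount n H = sumOver (permWords n) (λ w → indicator (does (peakWord w ≟ʷ H)))

peakCount-impossible : ∀ n H → (∀ w → peakWord w ≢ H) → peakCount n H ≡ 0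
peakCount-impossible n H impossible = go (permWords n)
  where
  go : ∀ ws → sumOver ws (λ w → indicator (does (peakWord w ≟ʷ H))) ≡ 0
  go []       = refl
  go (w ∷ ws) with peakWord w ≟ʷ H
  ... | yes e = ⊥-elim (impossible w e)
  ... | no _  = go ws

peakCount-first : ∀ n Y → peakCount n (true ∷ Y) ≡ 0
peakCount-first n Y = peakCount-impossible n _ (λ w → peakWord-first w Y)

peakCount-adjacent : ∀ n X Y → peakCount n (X ++ true ∷ true ∷ Y) ≡ 0
peakCount-adjacent n X Y = peakCount-impossible n _ (λ w → peakWord-adjacent w X Y)

peakCount-last : ∀ n X → peakCount n (X ++ true ∷ []) ≡ 0
peakCount-last n X = peakCount-impossible n _ (λ w → peakWord-last w X)

-- The multiset of peak words B with insertPeak B j ≡ H (resp. insertPeakAfter B j ≡ H),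
-- listed explicitly: the two neighbours of an inserted peak may have had either flag.
preimagesAfter : ℕ → List Bool → List (List Bool)
preimagesAfter zero          (false ∷ [])         = [] ∷ []
preimagesAfter zero          (true ∷ false ∷ G)   = (false ∷ G) ∷ (true ∷ G) ∷ []
preimagesAfter zero          _                    = []
preimagesAfter (suc j)       []                   = [] ∷ []
preimagesAfter (suc zero)    (false ∷ H)          = map (false ∷_) (preimagesAfter zero H) ++ map (true ∷_) (preimagesAfter zero H)
preimagesAfter (suc zero)    (true ∷ H)           = []
preimagesAfter (suc (suc j)) (h ∷ H)              = map (h ∷_) (preimagesAfter (suc j) H)

preimages : ℕ → List Bool → List (List Bool)
preimages zero    (false ∷ B) = B ∷ []
preimages zero    _           = []
preimages (suc j) []          = [] ∷ []
preimages (suc j) (e ∷ H)     = map (e ∷_) (preimagesAfter j H)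

countIn : List Bool → List (List Bool) → ℕ
countIn B Hs = sumOver Hs (λ C → indicator (does (B ≟ʷ C)))

countIn-map-∷ : ∀ e G h Hs → countIn (e ∷ G) (map (h ∷_) Hs) ≡ indicator (does (e BoolP.≟ h)) * countIn G Hs
countIn-map-∷ e G h []       = sym (ℕP.*-zeroʳ (indicator (does (e BoolP.≟ h))))
countIn-map-∷ e G h (C ∷ Hs) =
  trans (cong₂ _+_ (indicator-∧ (does (e BoolP.≟ h)) (does (G ≟ʷ C))) (countIn-map-∷ e G h Hs))
        (sym (ℕP.*-distribˡ-+ (indicator (does (e BoolP.≟ h))) _ _))

countIn-map-[] : ∀ h Hs → countIn [] (map (h ∷_) Hs) ≡ 0
countIn-map-[] h []       = refl
countIn-map-[] h (C ∷ Hs) = countIn-map-[] h Hs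

countIn-preimagesAfter : ∀ j G H → countIn G (preimagesAfter j H) ≡ indicator (does (insertPeakAfter G j ≟ʷ H))
countIn-preimagesAfter zero          []      []                     = refl
countIn-preimagesAfter zero          (g ∷ G) []                     = refl
countIn-preimagesAfter zero          []      (false ∷ [])           = refl
countIn-preimagesAfter zero          (g ∷ G) (false ∷ [])           = refl
countIn-preimagesAfter zero          []      (false ∷ h ∷ H)        = refl
countIn-preimagesAfter zero          (g ∷ G) (false ∷ h ∷ H)        = refl
countIn-preimagesAfter zero          []      (true ∷ [])            = refl
countIn-preimagesAfter zero          (g ∷ G) (true ∷ [])            = refl
countIn-preimagesAfter zero          []      (true ∷ false ∷ H)     = refl
countIn-preimagesAfter zero          (true ∷ G) (true ∷ false ∷ H)  = ℕP.+-identityʳ _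
countIn-preimagesAfter zero          (false ∷ G) (true ∷ false ∷ H) = ℕP.+-identityʳ _
countIn-preimagesAfter zero          []      (true ∷ true ∷ H)      = refl
countIn-preimagesAfter zero          (g ∷ G) (true ∷ true ∷ H)      = refl
countIn-preimagesAfter (suc j)       []      []                     = refl
countIn-preimagesAfter (suc zero)    (g ∷ G) []                     = refl
countIn-preimagesAfter (suc (suc j)) (g ∷ G) []                     = refl
countIn-preimagesAfter (suc zero)    []      (false ∷ H) =
  trans (sumOver-++ (map (false ∷_) (preimagesAfter zero H)) _ _)
        (cong₂ _+_ (countIn-map-[] false (preimagesAfter zero H)) (countIn-map-[] true (preimagesAfter zero H)))
countIn-preimagesAfter (suc zero)    (g ∷ G) (false ∷ H) =
  trans (sumOver-++ (map (false ∷_) (preimagesAfter zero H)) _ _)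
  (trans (cong₂ _+_ (countIn-map-∷ g G false (preimagesAfter zero H)) (countIn-map-∷ g G true (preimagesAfter zero H)))
  (trans (either-flag g (countIn G (preimagesAfter zero H))) (countIn-preimagesAfter zero G H)))
  where
  either-flag : ∀ g x → indicator (does (g BoolP.≟ false)) * x + indicator (does (g BoolP.≟ true)) * x ≡ x
  either-flag true  x = ℕP.+-identityʳ x
  either-flag false x = trans (ℕP.+-identityʳ _) (ℕP.+-identityʳ x)
countIn-preimagesAfter (suc zero)    []      (true ∷ H) = refl
countIn-preimagesAfter (suc zero)    (g ∷ G) (true ∷ H) = refl
countIn-preimagesAfter (suc (suc j)) []      (h ∷ H)    = countIn-map-[] h (preimagesAfter (suc j) H)
countIn-preimagesAfter (suc (suc j)) (g ∷ G) (h ∷ H)    =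
  trans (countIn-map-∷ g G h (preimagesAfter (suc j) H))
  (trans (cong (indicator (does (g BoolP.≟ h)) *_) (countIn-preimagesAfter (suc j) G H))
         (sym (indicator-∧ (does (g BoolP.≟ h)) _)))

countIn-preimages : ∀ j B H → countIn B (preimages j H) ≡ indicator (does (insertPeak B j ≟ʷ H))
countIn-preimages zero    B       []          = refl
countIn-preimages zero    B       (false ∷ H) = ℕP.+-identityʳ _
countIn-preimages zero    B       (true ∷ H)  = refl
countIn-preimages (suc j) []      []          = refl
countIn-preimages (suc j) (e ∷ G) []          = refl
countIn-preimages (suc j) []      (h ∷ H)     = countIn-map-[] h (preimagesAfter j H)
countIn-preimages (suc j) (e ∷ G) (h ∷ H)     =
  trans (countIn-map-∷ e G h (preimagesAfter j H))
  (trans (cong (indicator (does (e BoolP.≟ h)) *_) (countIn-preimagesAfter j G H))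
         (sym (indicator-∧ (does (e BoolP.≟ h)) _)))

-- The insertion recurrence: a permutation word of length n+1 is an old word with n inserted at
-- some position j, and its peak word is H exactly when the old peak word is a preimage of H.
peakCount-suc : ∀ n H → peakCount (suc n) H ≡ sumOver (upTo (suc n)) (λ j → sumOver (preimages j H) (peakCount n))
peakCount-suc n H =
  trans (sumOver-cartesianProductWith (λ w j → insertAt w j n) (permWords n) (upTo (suc n)) _)
  (trans (sumOver-cong (permWords n) (λ w w∈ → sumOver-cong (upTo (suc n)) (λ j j∈ → by-preimages w w∈ j j∈)))
  (trans (sumOver-swap (permWords n) (upTo (suc n)) _)
         (sumOver-cong (upTo (suc n)) (λ j _ → sumOver-swap (permWords n) (preimages j H) _))))
  where
  by-preimages : ∀ w → w ∈ permWords n → ∀ j → j ∈ upTo (suc n) →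
    indicator (does (peakWord (insertAt w j n) ≟ʷ H)) ≡ sumOver (preimages j H) (λ B → indicator (does (peakWord w ≟ʷ B)))
  by-preimages w w∈ j j∈
    with good@(_ , bounded , _) ← permWords-sound n w w∈
    with j≤ , _ ← insertion-valid good j∈ =
    trans (cong (λ B → indicator (does (B ≟ʷ H))) (peakWord-insertAt w j n j≤ (All.tabulate (bounded _))))
          (sym (countIn-preimages j (peakWord w) H))

-- For a word false ∷ H the insertions at
-- position 0 and 1 are explicit; laterInsertions collects the positions ≥ 2, which can be
-- walked through H from left to right.
laterInsertions : ℕ → List Bool → (List Bool → ℕ) → ℕ
laterInsertions n H g = sumOver (upTo n) (λ j → sumOver (preimagesAfter (suc j) H) g)

sumOver-upTo-suc : ∀ n (f : ℕ → ℕ) → sumOver (upTo (suc n)) f ≡ f 0 + sumOver (upTo n) (f ∘ suc)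
sumOver-upTo-suc n f = trans (cong (λ js → sumOver js f) (upTo-suc n)) (cong (_+_ (f 0)) (sumOver-map suc (upTo n) f))

peakCount-cons : ∀ n H → let g = λ C → peakCount (suc n) (false ∷ C) in
  peakCount (suc (suc n)) (false ∷ H) ≡
  peakCount (suc n) H + (sumOver (preimagesAfter 0 H) g + laterInsertions n H g)
peakCount-cons n H = begin
  peakCount (suc (suc n)) (false ∷ H)
    ≡⟨ peakCount-suc (suc n) (false ∷ H) ⟩
  sumOver (upTo (suc (suc n))) (λ j → sumOver (preimages j (false ∷ H)) (peakCount (suc n)))
    ≡⟨ sumOver-upTo-suc (suc n) (λ j → sumOver (preimages j (false ∷ H)) (peakCount (suc n))) ⟩
  (peakCount (suc n) H + 0) + sumOver (upTo (suc n)) (λ j → sumOver (map (false ∷_) (preimagesAfter j H)) (peakCount (suc n)))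
    ≡⟨ cong₂ _+_ (ℕP.+-identityʳ (peakCount (suc n) H)) (sumOver-cong (upTo (suc n)) (λ j _ → sumOver-map (false ∷_) (preimagesAfter j H) _)) ⟩
  peakCount (suc n) H + sumOver (upTo (suc n)) (λ j → sumOver (preimagesAfter j H) g)
    ≡⟨ cong (_+_ (peakCount (suc n) H)) (sumOver-upTo-suc n _) ⟩
  peakCount (suc n) H + (sumOver (preimagesAfter 0 H) g + laterInsertions n H g) ∎
  where
  open ≡-Reasoning
  g = λ C → peakCount (suc n) (false ∷ C)

laterInsertions-cons : ∀ n h H g →
  laterInsertions (suc n) (h ∷ H) g ≡ sumOver (preimagesAfter 1 (h ∷ H)) g + laterInsertions n H (g ∘ (h ∷_))
laterInsertions-cons n h H g =
  trans (sumOver-upTo-suc n _)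
        (cong (_+_ (sumOver (preimagesAfter 1 (h ∷ H)) g))
              (sumOver-cong (upTo n) (λ j _ → sumOver-map (h ∷_) (preimagesAfter (suc j) H) g)))

flat : ℕ → List Bool
flat n = List.replicate n false

flat-++ : ∀ a b → flat a ++ flat b ≡ flat (a + b)
flat-++ zero    b = refl
flat-++ (suc a) b = cong (false ∷_) (flat-++ a b)

flat-++-false : ∀ a X → flat a ++ false ∷ X ≡ false ∷ (flat a ++ X)
flat-++-false zero    X = refl
flat-++-false (suc a) X = cong (false ∷_) (flat-++-false a X)

-- Inserting inside a run of non-peaks never produces the word, so a run is skipped.
laterInsertions-skipRun : ∀ a m z Z g →
  laterInsertions (a + suc m) (false ∷ flat a ++ z ∷ Z) g ≡ laterInsertions (suc m) (false ∷ z ∷ Z) (g ∘ (flat a ++_))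
laterInsertions-skipRun zero          m z Z g = refl
laterInsertions-skipRun (suc zero)    m z Z g = laterInsertions-cons (suc m) false (false ∷ z ∷ Z) g
laterInsertions-skipRun (suc (suc a)) m z Z g =
  trans (laterInsertions-cons (suc a + suc m) false (false ∷ flat (suc a) ++ z ∷ Z) g)
        (laterInsertions-skipRun (suc a) m z Z (g ∘ (false ∷_)))

-- The end of the word: two preimages remain, the second of which ends with a peak (so it is
-- never a peak word and callers discard it).
laterInsertions-end : ∀ k g → laterInsertions (suc k) (false ∷ false ∷ flat k) g ≡ g (flat (suc k)) + g (flat k ++ true ∷ [])
laterInsertions-end zero    g = trans (ℕP.+-identityʳ _) (cong (_+_ (g (false ∷ []))) (ℕP.+-identityʳ _))
laterInsertions-end (suc k) g = trans (laterInsertions-cons (suc k) false (false ∷ false ∷ flat k) g)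
                                      (laterInsertions-end k (g ∘ (false ∷_)))

peakCount-endsWithPeak : ∀ N X Y → peakCount N (X ++ Y ++ true ∷ []) ≡ 0
peakCount-endsWithPeak N X Y = trans (cong (peakCount N) (sym (ListP.++-assoc X Y (true ∷ [])))) (peakCount-last N (X ++ Y))

laterInsertions-afterLastPeak : ∀ d g → g [] ≡ 0 → (∀ X → g (X ++ true ∷ []) ≡ 0) →
  laterInsertions d (false ∷ flat d) g ≡ g (flat d)
laterInsertions-afterLastPeak zero    g g[]≡0 _     = sym g[]≡0
laterInsertions-afterLastPeak (suc k) g _     gT≡0 =
  trans (laterInsertions-end k g) (trans (cong (_+_ (g (flat (suc k)))) (gT≡0 (flat k))) (ℕP.+-identityʳ _))

-- The three counts the theorem needs: no peak, one peak at position a (0-based), and peaks at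
-- positions 1 and c+2.  twoPeaks c d counts P({2, c+3}; c+d+3) in the 1-based terms of Defs.
noPeaks : ℕ → ℕ
noPeaks a = peakCount a (flat a)

onePeak : ℕ → ℕ → ℕ
onePeak a b = peakCount (suc (a + b)) (flat a ++ true ∷ flat b)

twoPeakWord : ℕ → ℕ → List Bool
twoPeakWord c d = false ∷ true ∷ flat c ++ true ∷ flat d

twoPeaks : ℕ → ℕ → ℕ
twoPeaks c d = peakCount (suc (suc (suc (c + d)))) (twoPeakWord c d)

-- Removing the maximum from a peakless word leaves a peakless word, and it was at either end.
noPeaks-double : ∀ a → noPeaks (suc (suc a)) ≡ 2 * noPeaks (suc a)
noPeaks-double zero    = refl
noPeaks-double (suc a) = begin
  noPeaks (3 + a)
    ≡⟨ peakCount-cons (suc a) H ⟩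
  noPeaks (2 + a) + (0 + laterInsertions (suc a) H g)
    ≡⟨ cong (λ t → noPeaks (2 + a) + t) (laterInsertions-end a g) ⟩
  noPeaks (2 + a) + (noPeaks (2 + a) + g (flat a ++ true ∷ []))
    ≡⟨ cong (λ t → noPeaks (2 + a) + (noPeaks (2 + a) + t)) (peakCount-last (2 + a) (false ∷ flat a)) ⟩
  noPeaks (2 + a) + (noPeaks (2 + a) + 0)
    ≡⟨ twice (noPeaks (2 + a)) ⟩
  2 * noPeaks (2 + a) ∎
  where
  open ≡-Reasoning
  H = false ∷ false ∷ flat a
  g = λ C → peakCount (2 + a) (false ∷ C)
  twice : ∀ x → x + (x + 0) ≡ 2 * x
  twice = solve-∀

noPeaks-closed : ∀ a → noPeaks (suc a) ≡ 2 ^ a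
noPeaks-closed zero    = refl
noPeaks-closed (suc a) = trans (noPeaks-double a) (cong (2 *_) (noPeaks-closed a))

preimagesAfter-run : ∀ a X → preimagesAfter 0 (false ∷ flat a ++ true ∷ X) ≡ []
preimagesAfter-run zero    X = refl
preimagesAfter-run (suc a) X = refl

-- Recurrence for one peak: delete the maximum, which sits at the peak (its neighbours then
-- may or may not be peaks) or at the end of the word.
onePeak-rec : ∀ a b → onePeak (suc a) (suc b) ≡ 2 * onePeak a (suc b) + 2 * onePeak (suc a) b + noPeaks (suc a + suc b)
onePeak-rec zero b = begin
  onePeak 1 (suc b)
    ≡⟨ peakCount-cons (suc b) H ⟩
  onePeak 0 (suc b) + ((noPeaks (2 + b) + (onePeak 1 b + 0)) + laterInsertions (suc b) H g)
    ≡⟨ cong (λ t → onePeak 0 (suc b) + ((noPeaks (2 + b) + (onePeak 1 b + 0)) + t)) walk ⟩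
  onePeak 0 (suc b) + ((noPeaks (2 + b) + (onePeak 1 b + 0)) + (0 + onePeak 1 b))
    ≡⟨ cong (λ t → t + ((noPeaks (2 + b) + (onePeak 1 b + 0)) + (0 + onePeak 1 b))) (peakCount-first (suc (suc b)) (flat (suc b))) ⟩
  0 + ((noPeaks (2 + b) + (onePeak 1 b + 0)) + (0 + onePeak 1 b))
    ≡⟨ arrange (noPeaks (2 + b)) (onePeak 1 b) ⟩
  2 * 0 + 2 * onePeak 1 b + noPeaks (2 + b)
    ≡⟨ cong (λ t → 2 * t + 2 * onePeak 1 b + noPeaks (2 + b)) (sym (peakCount-first (suc (suc b)) (flat (suc b)))) ⟩
  2 * onePeak 0 (suc b) + 2 * onePeak 1 b + noPeaks (2 + b) ∎
  where
  open ≡-Reasoning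
  H = true ∷ false ∷ flat b
  g = λ C → peakCount (2 + b) (false ∷ C)
  walk : laterInsertions (suc b) H g ≡ 0 + onePeak 1 b
  walk = trans (laterInsertions-cons b true (false ∷ flat b) g)
               (cong (_+_ 0) (laterInsertions-afterLastPeak b (g ∘ (true ∷_))
                  (peakCount-last (2 + b) (false ∷ [])) (λ X → peakCount-last (2 + b) (false ∷ true ∷ X))))
  arrange : ∀ y z → 0 + ((y + (z + 0)) + (0 + z)) ≡ 2 * 0 + 2 * z + y
  arrange = solve-∀
onePeak-rec (suc a) b = begin
  onePeak (2 + a) (suc b)
    ≡⟨ peakCount-cons n H ⟩
  x + (sumOver (preimagesAfter 0 H) g + laterInsertions n H g)
    ≡⟨ cong (λ P → x + (sumOver P g + laterInsertions n H g)) (preimagesAfter-run a (false ∷ flat b)) ⟩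
  x + (0 + laterInsertions n H g)
    ≡⟨ cong (λ t → x + (0 + t)) walk ⟩
  x + (0 + ((g₁ (false ∷ false ∷ flat b) + (g₁ (false ∷ true ∷ flat b) + (x + (g₁ (true ∷ true ∷ flat b) + 0)))) + (0 + g₁ (false ∷ true ∷ flat b))))
    ≡⟨ cong₂ (λ u v → x + (0 + ((u + (v + (x + (g₁ (true ∷ true ∷ flat b) + 0)))) + (0 + v)))) allFlat peakShifted ⟩
  x + (0 + ((y + (z + (x + (g₁ (true ∷ true ∷ flat b) + 0)))) + (0 + z)))
    ≡⟨ cong (λ t → x + (0 + ((y + (z + (x + (t + 0)))) + (0 + z)))) (peakCount-adjacent (suc n) (false ∷ flat a) (flat b)) ⟩
  x + (0 + ((y + (z + (x + (0 + 0)))) + (0 + z)))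
    ≡⟨ arrange x y z ⟩
  2 * x + 2 * z + y ∎
  where
  open ≡-Reasoning
  n = suc (a + suc b)
  H = false ∷ flat a ++ true ∷ false ∷ flat b
  g = λ C → peakCount (suc n) (false ∷ C)
  g₁ = g ∘ (flat a ++_)
  x = onePeak (suc a) (suc b)
  y = noPeaks (2 + a + suc b)
  z = onePeak (2 + a) b
  -- The four ways the neighbours of the deleted peak may look.
  peakPatterns = sumOver (preimagesAfter 1 (false ∷ true ∷ false ∷ flat b)) g₁
  walk : laterInsertions n H g ≡ peakPatterns + (0 + g₁ (false ∷ true ∷ flat b))
  walk = begin
    laterInsertions n H g
      ≡⟨ cong (λ k → laterInsertions k H g) (sym (ℕP.+-suc a (suc b))) ⟩
    laterInsertions (a + suc (suc b)) H g
      ≡⟨ laterInsertions-skipRun a (suc b) true (false ∷ flat b) g ⟩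
    laterInsertions (2 + b) (false ∷ true ∷ false ∷ flat b) g₁
      ≡⟨ laterInsertions-cons (suc b) false (true ∷ false ∷ flat b) g₁ ⟩
    peakPatterns + laterInsertions (suc b) (true ∷ false ∷ flat b) (g₁ ∘ (false ∷_))
      ≡⟨ cong (_+_ peakPatterns) (laterInsertions-cons b true (false ∷ flat b) (g₁ ∘ (false ∷_))) ⟩
    peakPatterns + (0 + laterInsertions b (false ∷ flat b) (g₁ ∘ (false ∷_) ∘ (true ∷_)))
      ≡⟨ cong (λ t → peakPatterns + (0 + t)) (laterInsertions-afterLastPeak b _
           (peakCount-endsWithPeak (suc n) (false ∷ flat a) (false ∷ []))
           (λ X → peakCount-endsWithPeak (suc n) (false ∷ flat a) (false ∷ true ∷ X))) ⟩
    peakPatterns + (0 + g₁ (false ∷ true ∷ flat b)) ∎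
  allFlat : g₁ (false ∷ false ∷ flat b) ≡ y
  allFlat = cong (λ W → peakCount (suc n) (false ∷ W))
    (trans (flat-++ a (2 + b)) (cong flat (ℕP.+-suc a (suc b))))
  peakShifted : g₁ (false ∷ true ∷ flat b) ≡ z
  peakShifted = cong₂ peakCount (cong (_+_ 2) (ℕP.+-suc a b)) (cong (false ∷_) (flat-++-false a (true ∷ flat b)))
  arrange : ∀ x y z → x + (0 + ((y + (z + (x + (0 + 0)))) + (0 + z))) ≡ 2 * x + 2 * z + y
  arrange = solve-∀

-- Binomial coefficients by Pascal's rule (so that they compute), agreeing with the library's _C_.
binom : ℕ → ℕ → ℕ
binom n       zero    = 1
binom zero    (suc k) = 0
binom (suc n) (suc k) = binom n k + binom n (suc k)

binom≡C : ∀ n k → binom n k ≡ n C k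
binom≡C n       zero    = refl
binom≡C zero    (suc k) = refl
binom≡C (suc n) (suc k) = trans (cong₂ _+_ (binom≡C n k) (binom≡C n (suc k))) (nCk+nC[k+1]≡[n+1]C[k+1] n k)

binom-big : ∀ n k → n < k → binom n k ≡ 0
binom-big zero    (suc k) _         = refl
binom-big (suc n) (suc k) (s≤s n<k) = cong₂ _+_ (binom-big n k n<k) (binom-big n (suc k) (ℕP.m≤n⇒m≤1+n n<k))

binom-diag : ∀ n → binom n n ≡ 1
binom-diag zero    = refl
binom-diag (suc n) = cong₂ _+_ (binom-diag n) (binom-big n (suc n) ℕP.≤-refl)

binom-1 : ∀ n → binom n 1 ≡ n
binom-1 zero    = refl
binom-1 (suc n) = cong suc (binom-1 n)

-- Closed form for one peak: onePeak a b = 2^(a+b-1) (binom (a+b) a - 1), in additive form.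
onePeak-closed : ∀ a b → onePeak a b + 2 ^ ℕ.pred (a + b) ≡ 2 ^ ℕ.pred (a + b) * binom (a + b) a
onePeak-closed zero    b       =
  trans (cong (_+ 2 ^ ℕ.pred b) (peakCount-first (suc b) (flat b))) (sym (ℕP.*-identityʳ (2 ^ ℕ.pred b)))
onePeak-closed (suc a) zero    =
  trans (cong (_+ 2 ^ ℕ.pred (suc a + 0)) (peakCount-last (suc (suc a + 0)) (flat (suc a))))
        (sym (trans (cong (2 ^ ℕ.pred (suc a + 0) *_) (trans (cong (λ k → binom k (suc a)) (ℕP.+-identityʳ (suc a))) (binom-diag (suc a))))
                    (ℕP.*-identityʳ _)))
onePeak-closed (suc a) (suc b) = begin
  onePeak (suc a) (suc b) + 2 ^ (a + suc b)
    ≡⟨ cong (_+ 2 ^ (a + suc b)) (onePeak-rec a b) ⟩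
  2 * x + 2 * y + noPeaks (suc a + suc b) + 2 ^ (a + suc b)
    ≡⟨ cong₂ (λ s t → 2 * x + 2 * y + s + t) (trans (noPeaks-closed (a + suc b)) p≡2q) p≡2q ⟩
  2 * x + 2 * y + 2 * q + 2 * q
    ≡⟨ combine x y q u v ih₁ (onePeak-closed (suc a) b) ⟩
  2 * q * (u + v)
    ≡⟨ cong₂ _*_ (sym p≡2q) (cong (λ k → u + binom k (suc a)) (sym (ℕP.+-suc a b))) ⟩
  2 ^ (a + suc b) * binom (suc a + suc b) (suc a) ∎
  where
  open ≡-Reasoning
  x = onePeak a (suc b)
  y = onePeak (suc a) b
  q = 2 ^ (a + b)
  u = binom (a + suc b) a
  v = binom (suc a + b) (suc a)
  p≡2q : 2 ^ (a + suc b) ≡ 2 * q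
  p≡2q = cong (2 ^_) (ℕP.+-suc a b)
  ih₁ : x + q ≡ q * u
  ih₁ = subst (λ e → x + 2 ^ e ≡ 2 ^ e * u) (cong ℕ.pred (ℕP.+-suc a b)) (onePeak-closed a (suc b))
  combine : ∀ x y q u v → x + q ≡ q * u → y + q ≡ q * v → 2 * x + 2 * y + 2 * q + 2 * q ≡ 2 * q * (u + v)
  combine x y q u v ex ey = begin
    2 * x + 2 * y + 2 * q + 2 * q ≡⟨ regroup x y q ⟩
    2 * (x + q) + 2 * (y + q)     ≡⟨ cong₂ (λ s t → 2 * s + 2 * t) ex ey ⟩
    2 * (q * u) + 2 * (q * v)     ≡⟨ factor q u v ⟩
    2 * q * (u + v)               ∎
    where
    regroup : ∀ x y q → 2 * x + 2 * y + 2 * q + 2 * q ≡ 2 * (x + q) + 2 * (y + q)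
    regroup = solve-∀
    factor : ∀ q u v → 2 * (q * u) + 2 * (q * v) ≡ 2 * q * (u + v)
    factor = solve-∀

twoPeaks-rec : ∀ c d → twoPeaks (suc c) (suc d) ≡
  2 * twoPeaks c (suc d) + 2 * twoPeaks (suc c) d + onePeak (2 + c) (suc d) + onePeak 1 (2 + c + d)
twoPeaks-rec c d = begin
  twoPeaks (suc c) (suc d)
    ≡⟨ peakCount-cons n H ⟩
  peakCount (suc n) H + ((onePeak (2 + c) (suc d) + (twoPeaks c (suc d) + 0)) + laterInsertions n H g)
    ≡⟨ cong₂ (λ s t → s + ((onePeak (2 + c) (suc d) + (twoPeaks c (suc d) + 0)) + t))
             (peakCount-first (suc n) (false ∷ G)) walk ⟩
  0 + ((y + (x + 0)) + (0 + (g₂ (false ∷ false ∷ flat d) + (g₂ (false ∷ true ∷ flat d) + (x + (g₂ (true ∷ true ∷ flat d) + 0)))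
                          + (0 + g₂ (false ∷ true ∷ flat d)))))
    ≡⟨ cong₂ (λ u v → 0 + ((y + (x + 0)) + (0 + (u + (v + (x + (g₂ (true ∷ true ∷ flat d) + 0))) + (0 + v)))))
             otherPeakAlone peakShifted ⟩
  0 + ((y + (x + 0)) + (0 + (w + (z + (x + (g₂ (true ∷ true ∷ flat d) + 0))) + (0 + z))))
    ≡⟨ cong (λ t → 0 + ((y + (x + 0)) + (0 + (w + (z + (x + (t + 0))) + (0 + z)))))
            (peakCount-adjacent (suc n) (false ∷ true ∷ flat c) (flat d)) ⟩
  0 + ((y + (x + 0)) + (0 + (w + (z + (x + (0 + 0))) + (0 + z))))
    ≡⟨ arrange x y z w ⟩
  2 * x + 2 * z + y + w ∎
  where
  open ≡-Reasoning
  n = suc (suc (c + suc d))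
  G = flat c ++ true ∷ false ∷ flat d
  H = true ∷ false ∷ G
  g = λ C → peakCount (suc n) (false ∷ C)
  g₂ = g ∘ (true ∷_) ∘ (flat c ++_)
  x = twoPeaks c (suc d)
  y = onePeak (2 + c) (suc d)
  z = twoPeaks (suc c) d
  w = onePeak 1 (2 + c + d)
  -- The four ways the neighbours of the deleted second peak may look.
  peakPatterns = sumOver (preimagesAfter 1 (false ∷ true ∷ false ∷ flat d)) g₂
  walk : laterInsertions n H g ≡ 0 + (peakPatterns + (0 + g₂ (false ∷ true ∷ flat d)))
  walk = begin
    laterInsertions n H g
      ≡⟨ laterInsertions-cons (suc (c + suc d)) true (false ∷ G) g ⟩
    0 + laterInsertions (suc (c + suc d)) (false ∷ G) (g ∘ (true ∷_))
      ≡⟨ cong (λ k → 0 + laterInsertions k (false ∷ G) (g ∘ (true ∷_))) (sym (ℕP.+-suc c (suc d))) ⟩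
    0 + laterInsertions (c + suc (suc d)) (false ∷ G) (g ∘ (true ∷_))
      ≡⟨ cong (_+_ 0) (laterInsertions-skipRun c (suc d) true (false ∷ flat d) (g ∘ (true ∷_))) ⟩
    0 + laterInsertions (2 + d) (false ∷ true ∷ false ∷ flat d) g₂
      ≡⟨ cong (_+_ 0) (laterInsertions-cons (suc d) false (true ∷ false ∷ flat d) g₂) ⟩
    0 + (peakPatterns + laterInsertions (suc d) (true ∷ false ∷ flat d) (g₂ ∘ (false ∷_)))
      ≡⟨ cong (λ t → 0 + (peakPatterns + t)) (laterInsertions-cons d true (false ∷ flat d) (g₂ ∘ (false ∷_))) ⟩
    0 + (peakPatterns + (0 + laterInsertions d (false ∷ flat d) (g₂ ∘ (false ∷_) ∘ (true ∷_))))
      ≡⟨ cong (λ t → 0 + (peakPatterns + (0 + t))) (laterInsertions-afterLastPeak d _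
           (peakCount-endsWithPeak (suc n) (false ∷ true ∷ flat c) (false ∷ []))
           (λ X → peakCount-endsWithPeak (suc n) (false ∷ true ∷ flat c) (false ∷ true ∷ X))) ⟩
    0 + (peakPatterns + (0 + g₂ (false ∷ true ∷ flat d))) ∎
  otherPeakAlone : g₂ (false ∷ false ∷ flat d) ≡ w
  otherPeakAlone = cong₂ peakCount (cong (_+_ 3) (ℕP.+-suc c d))
    (cong (λ W → false ∷ true ∷ W) (trans (flat-++ c (2 + d)) (cong flat (trans (ℕP.+-suc c (suc d)) (cong suc (ℕP.+-suc c d))))))
  peakShifted : g₂ (false ∷ true ∷ flat d) ≡ z
  peakShifted = cong₂ peakCount (cong (_+_ 3) (ℕP.+-suc c d)) (cong (λ W → false ∷ true ∷ W) (flat-++-false c (true ∷ flat d)))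
  arrange : ∀ x y z w → 0 + ((y + (x + 0)) + (0 + (w + (z + (x + (0 + 0))) + (0 + z)))) ≡ 2 * x + 2 * z + y + w
  arrange = solve-∀

-- twoPeaks c d = 2^(c+d) (c·binom(c+d+1, c+2) + (c+1)·binom(c+d+1, c+1) - (c+d+1)).
twoPeakBinomials : ℕ → ℕ → ℕ
twoPeakBinomials c d = c * binom (suc (c + d)) (2 + c) + suc c * binom (suc (c + d)) (suc c)

-- The arithmetic of the induction step of twoPeaks-closed: the recurrence is compatible with
-- the closed form, by Pascal's rule.
twoPeaks-step : ∀ c s p D₁ D₂ B₁ B₂ u v w →
  D₁ + p * s ≡ p * (c * v + suc c * u) →
  D₂ + p * s ≡ p * (suc c * w + (2 + c) * v) →
  B₁ + 2 * p ≡ 2 * p * (u + v) →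
  B₂ + 2 * p ≡ 2 * p * suc s →
  2 * D₁ + 2 * D₂ + B₁ + B₂ + 2 * p * suc s ≡ 2 * p * (suc c * (v + w) + (2 + c) * (u + v))
twoPeaks-step c s p D₁ D₂ B₁ B₂ u v w e₁ e₂ e₃ e₄ = ℕP.+-cancelʳ-≡ K _ _ (begin
  2 * D₁ + 2 * D₂ + B₁ + B₂ + 2 * p * suc s + K
    ≡⟨ regroup D₁ D₂ B₁ B₂ p s ⟩
  2 * (D₁ + p * s) + 2 * (D₂ + p * s) + (B₁ + 2 * p) + (B₂ + 2 * p) + 2 * p * suc s
    ≡⟨ cong₂ (λ t₁ t₂ → t₁ + t₂ + 2 * p * suc s)
             (cong₂ _+_ (cong₂ (λ a b → 2 * a + 2 * b) e₁ e₂) e₃) e₄ ⟩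
  2 * (p * (c * v + suc c * u)) + 2 * (p * (suc c * w + (2 + c) * v)) + 2 * p * (u + v) + 2 * p * suc s + 2 * p * suc s
    ≡⟨ expand c s p u v w ⟩
  2 * p * (suc c * (v + w) + (2 + c) * (u + v)) + K ∎)
  where
  open ≡-Reasoning
  K = 2 * (p * s) + 2 * (p * s) + 2 * p + 2 * p
  regroup : ∀ D₁ D₂ B₁ B₂ p s →
    2 * D₁ + 2 * D₂ + B₁ + B₂ + 2 * p * suc s + (2 * (p * s) + 2 * (p * s) + 2 * p + 2 * p) ≡
    2 * (D₁ + p * s) + 2 * (D₂ + p * s) + (B₁ + 2 * p) + (B₂ + 2 * p) + 2 * p * suc s
  regroup = solve-∀
  expand : ∀ c s p u v w →
    2 * (p * (c * v + suc c * u)) + 2 * (p * (suc c * w + (2 + c) * v)) + 2 * p * (u + v) + 2 * p * suc s + 2 * p * suc s ≡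
    2 * p * (suc c * (v + w) + (2 + c) * (u + v)) + (2 * (p * s) + 2 * (p * s) + 2 * p + 2 * p)
  expand = solve-∀

twoPeaks-closed : ∀ c d → twoPeaks c d + 2 ^ (c + d) * suc (c + d) ≡ 2 ^ (c + d) * twoPeakBinomials c d
twoPeaks-closed zero    d       =
  trans (cong (_+ 2 ^ d * suc d) (peakCount-adjacent (3 + d) (false ∷ []) (flat d)))
        (cong (2 ^ d *_) (sym (trans (ℕP.+-identityʳ _) (binom-1 (suc d)))))
twoPeaks-closed (suc c) zero    =
  trans (cong (_+ 2 ^ (suc c + 0) * suc (suc c + 0)) (peakCount-last (3 + (suc c + 0)) (false ∷ true ∷ flat (suc c))))
        (lastPeakOnly (suc c + 0) (ℕP.+-identityʳ (suc c)))
  where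
  lastPeakOnly : ∀ k → k ≡ suc c → 0 + 2 ^ k * suc k ≡ 2 ^ k * (suc c * binom (suc k) (3 + c) + (2 + c) * binom (suc k) (2 + c))
  lastPeakOnly k refl = cong (2 ^ k *_) (sym (begin
    suc c * binom (suc k) (3 + c) + (2 + c) * binom (suc k) (2 + c)
      ≡⟨ cong₂ (λ s t → suc c * s + (2 + c) * t) (binom-big (suc k) (suc (suc k)) (s≤s (ℕP.n<1+n k))) (binom-diag (suc k)) ⟩
    suc c * 0 + (2 + c) * 1
      ≡⟨ simplify (suc c) ⟩
    suc (suc c) ∎))
    where
    open ≡-Reasoning
    simplify : ∀ x → x * 0 + suc x * 1 ≡ suc x
    simplify = solve-∀
twoPeaks-closed (suc c) (suc d) = begin
  twoPeaks (suc c) (suc d) + 2 * p * suc s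
    ≡⟨ cong (_+ 2 * p * suc s) (twoPeaks-rec c d) ⟩
  2 * twoPeaks c (suc d) + 2 * twoPeaks (suc c) d + onePeak (2 + c) (suc d) + onePeak 1 (2 + c + d) + 2 * p * suc s
    ≡⟨ twoPeaks-step c s p _ _ _ _ u v w (twoPeaks-closed c (suc d)) ih₂ (onePeak-closed (2 + c) (suc d)) e₄ ⟩
  2 * p * twoPeakBinomials (suc c) (suc d) ∎
  where
  open ≡-Reasoning
  s = suc (c + suc d)
  p = 2 ^ (c + suc d)
  u = binom s (suc c)
  v = binom s (2 + c)
  w = binom s (3 + c)
  ih₂ : twoPeaks (suc c) d + p * s ≡ p * (suc c * w + (2 + c) * v)
  ih₂ = subst (λ k → twoPeaks (suc c) d + 2 ^ k * suc k ≡ 2 ^ k * (suc c * binom (suc k) (3 + c) + (2 + c) * binom (suc k) (2 + c)))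
              (sym (ℕP.+-suc c d)) (twoPeaks-closed (suc c) d)
  e₄ : onePeak 1 (2 + c + d) + 2 * p ≡ 2 * p * suc s
  e₄ = subst (λ k → onePeak 1 (2 + c + d) + 2 ^ k ≡ 2 ^ k * suc k) (cong suc (sym (ℕP.+-suc c d)))
             (trans (onePeak-closed 1 (2 + c + d)) (cong (2 ^ suc (suc (c + d)) *_) (binom-1 _)))

sumUpTo : ℕ → (ℕ → ℕ) → ℕ
sumUpTo zero    f = f 0
sumUpTo (suc t) f = sumUpTo t f + f (suc t)

sumUpTo-cong : ∀ t {f g : ℕ → ℕ} → (∀ k → f k ≡ g k) → sumUpTo t f ≡ sumUpTo t g
sumUpTo-cong zero    e = e 0
sumUpTo-cong (suc t) e = cong₂ _+_ (sumUpTo-cong t e) (e (suc t))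

sumUpTo-+ : ∀ t (f g : ℕ → ℕ) → sumUpTo t (λ k → f k + g k) ≡ sumUpTo t f + sumUpTo t g
sumUpTo-+ zero    f g = refl
sumUpTo-+ (suc t) f g =
  trans (cong (_+ (f (suc t) + g (suc t))) (sumUpTo-+ t f g)) (interchange (sumUpTo t f) (sumUpTo t g) _ _)
  where
  interchange : ∀ a b x y → a + b + (x + y) ≡ a + x + (b + y)
  interchange = solve-∀

sumUpTo-* : ∀ t c (f : ℕ → ℕ) → sumUpTo t (λ k → c * f k) ≡ c * sumUpTo t f
sumUpTo-* zero    c f = refl
sumUpTo-* (suc t) c f = trans (cong (_+ c * f (suc t)) (sumUpTo-* t c f)) (sym (ℕP.*-distribˡ-+ c (sumUpTo t f) (f (suc t))))

sumUpTo-zero : ∀ t (f : ℕ → ℕ) → (∀ k → f k ≡ 0) → sumUpTo t f ≡ 0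
sumUpTo-zero zero    f e = e 0
sumUpTo-zero (suc t) f e = cong₂ _+_ (sumUpTo-zero t f e) (e (suc t))

sumUpTo-shift : ∀ t (f : ℕ → ℕ) → sumUpTo (suc t) f ≡ f 0 + sumUpTo t (f ∘ suc)
sumUpTo-shift zero    f = refl
sumUpTo-shift (suc t) f = trans (cong (_+ f (suc (suc t))) (sumUpTo-shift t f)) (ℕP.+-assoc (f 0) _ _)

binomialSum : ℕ → (ℕ → ℕ) → ℕ
binomialSum t g = sumUpTo t (λ k → g k * binom t k)

binomialSum-suc : ∀ t g → binomialSum (suc t) g ≡ binomialSum t g + binomialSum t (g ∘ suc)
binomialSum-suc t g = begin
  binomialSum (suc t) g
    ≡⟨ sumUpTo-shift t (λ k → g k * binom (suc t) k) ⟩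
  g 0 * 1 + sumUpTo t (λ k → g (suc k) * (binom t k + binom t (suc k)))
    ≡⟨ cong (_+_ (g 0 * 1)) (trans (sumUpTo-cong t (λ k → ℕP.*-distribˡ-+ (g (suc k)) (binom t k) (binom t (suc k))))
                                  (sumUpTo-+ t _ _)) ⟩
  g 0 * 1 + (binomialSum t (g ∘ suc) + Y)
    ≡⟨ swap (g 0 * 1) (binomialSum t (g ∘ suc)) Y ⟩
  (g 0 * 1 + Y) + binomialSum t (g ∘ suc)
    ≡⟨ cong (_+ binomialSum t (g ∘ suc)) (sym unshift) ⟩
  binomialSum t g + binomialSum t (g ∘ suc) ∎
  where
  open ≡-Reasoning
  Y = sumUpTo t (λ k → g (suc k) * binom t (suc k))
  swap : ∀ x y z → x + (y + z) ≡ x + z + y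
  swap = solve-∀
  -- the top term g (t+1) · binom t (t+1) vanishes, so the sum may be shifted
  unshift : binomialSum t g ≡ g 0 * 1 + Y
  unshift = begin
    binomialSum t g                          ≡⟨ ℕP.+-identityʳ _ ⟨
    binomialSum t g + 0                      ≡⟨ cong (_+_ (binomialSum t g)) (sym (trans (cong (g (suc t) *_) (binom-big t (suc t) ℕP.≤-refl)) (ℕP.*-zeroʳ (g (suc t))))) ⟩
    binomialSum t g + g (suc t) * binom t (suc t) ≡⟨ sumUpTo-shift t (λ k → g k * binom t k) ⟩
    g 0 * 1 + Y                              ∎

binom-sym : ∀ x y → binom (x + y) x ≡ binom (x + y) y
binom-sym zero    y       = sym (binom-diag y)
binom-sym (suc x) zero    = trans (cong (λ z → binom z (suc x)) (ℕP.+-identityʳ (suc x))) (binom-diag (suc x))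
binom-sym (suc x) (suc y) =
  trans (cong₂ _+_ (binom-sym x (suc y))
                   (trans (cong (λ z → binom z (suc x)) (ℕP.+-suc x y))
                   (trans (binom-sym (suc x) y) (cong (λ z → binom z y) (sym (ℕP.+-suc x y))))))
        (ℕP.+-comm (binom (x + suc y) (suc y)) (binom (x + suc y) y))

binomBelow : ℕ → ℕ → ℕ
binomBelow a zero    = 0
binomBelow a (suc j) = binom a j

vandermonde : ∀ a t r u → r + u ≡ suc a → binomialSum t (λ k → binomBelow a (k + r)) ≡ binom (a + t) u
vandermonde a zero    zero    u e =
  sym (trans (cong (λ z → binom z u) (ℕP.+-identityʳ a)) (binom-big a u (subst (a <_) (sym e) ℕP.≤-refl)))
vandermonde a zero    (suc r) u e = trans (ℕP.*-identityʳ (binom a r))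
  (trans (cong (λ z → binom z r) (sym r+u≡a)) (trans (binom-sym r u) (cong (λ z → binom z u) (trans r+u≡a (sym (ℕP.+-identityʳ a))))))
  where
  r+u≡a : r + u ≡ a
  r+u≡a = ℕP.suc-injective e
vandermonde a (suc t) r u e = begin
  binomialSum (suc t) (λ k → binomBelow a (k + r))
    ≡⟨ binomialSum-suc t (λ k → binomBelow a (k + r)) ⟩
  binomialSum t (λ k → binomBelow a (k + r)) + binomialSum t (λ k → binomBelow a (suc k + r))
    ≡⟨ cong (_+_ _) (sumUpTo-cong t (λ k → cong (λ z → binomBelow a z * binom t k) (sym (ℕP.+-suc k r)))) ⟩
  binomialSum t (λ k → binomBelow a (k + r)) + binomialSum t (λ k → binomBelow a (k + suc r))
    ≡⟨ pascal u e ⟩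
  binom (a + suc t) u ∎
  where
  open ≡-Reasoning
  pascal : ∀ u → r + u ≡ suc a →
    binomialSum t (λ k → binomBelow a (k + r)) + binomialSum t (λ k → binomBelow a (k + suc r)) ≡ binom (a + suc t) u
  pascal zero    e′ = cong₂ _+_ (vandermonde a t r zero e′) (sumUpTo-zero t _ (λ k → cong (_* binom t k) (vanishes k)))
    where
    vanishes : ∀ k → binomBelow a (k + suc r) ≡ 0
    vanishes k = trans (cong (binomBelow a) (ℕP.+-suc k r))
      (binom-big a (k + r) (subst (λ q → a < k + q) (sym (trans (sym (ℕP.+-identityʳ r)) e′)) (ℕP.≤-trans (ℕP.n<1+n a) (ℕP.m≤n+m (suc a) k))))
  pascal (suc u′) e′ =
    trans (cong₂ _+_ (vandermonde a t r (suc u′) e′) (vandermonde a t (suc r) u′ (trans (sym (ℕP.+-suc r u′)) e′)))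
          (trans (ℕP.+-comm (binom (a + t) (suc u′)) (binom (a + t) u′)) (cong (λ z → binom z (suc u′)) (sym (ℕP.+-suc a t))))

difference-* : ∀ x y z → (+ x ℤ.- + y) ℤ.* + z ≡ + (x * z) ℤ.- + (y * z)
difference-* x y z = trans (distrib (+ x) (+ y) (+ z)) (sym (cong₂ ℤ._-_ (ℤP.pos-* x z) (ℤP.pos-* y z)))
  where
  distrib : ∀ x y z → (x ℤ.- y) ℤ.* z ≡ x ℤ.* z ℤ.- y ℤ.* z
  distrib = ℤSolver.solve-∀

sumTo-difference : ∀ t (f g h : ℕ → ℕ) →
  sumTo t (λ k → (+ f k ℤ.- + g k) ℤ.* + h k) ≡ + sumUpTo t (λ k → f k * h k) ℤ.- + sumUpTo t (λ k → g k * h k)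
sumTo-difference zero    f g h = difference-* (f 0) (g 0) (h 0)
sumTo-difference (suc t) f g h = begin
  sumTo t F ℤ.+ F (suc t)
    ≡⟨ cong₂ ℤ._+_ (sumTo-difference t f g h) (difference-* (f (suc t)) (g (suc t)) (h (suc t))) ⟩
  (+ Σf ℤ.- + Σg) ℤ.+ (+ (f (suc t) * h (suc t)) ℤ.- + (g (suc t) * h (suc t)))
    ≡⟨ regroup (+ Σf) (+ Σg) (+ (f (suc t) * h (suc t))) (+ (g (suc t) * h (suc t))) ⟩
  (+ Σf ℤ.+ + (f (suc t) * h (suc t))) ℤ.- (+ Σg ℤ.+ + (g (suc t) * h (suc t)))
    ≡⟨ sym (cong₂ ℤ._-_ (ℤP.pos-+ Σf _) (ℤP.pos-+ Σg _)) ⟩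
  + sumUpTo (suc t) (λ k → f k * h k) ℤ.- + sumUpTo (suc t) (λ k → g k * h k) ∎
  where
  open ≡-Reasoning
  F = λ k → (+ f k ℤ.- + g k) ℤ.* + h k
  Σf = sumUpTo t (λ k → f k * h k)
  Σg = sumUpTo t (λ k → g k * h k)
  regroup : ∀ a b x y → (a ℤ.- b) ℤ.+ (x ℤ.- y) ≡ (a ℤ.+ x) ℤ.- (b ℤ.+ y)
  regroup = ℤSolver.solve-∀

Cformula-binomBelow : ∀ c k → Cformula (3 + c) k ≡
  + (c * binomBelow (suc c) (k + 0) + suc c * binomBelow (suc c) (k + 1)) ℤ.- + binomBelow (suc c) (k + suc c)
Cformula-binomBelow c k =
  trans (cong₂ (λ s t → s ℤ.+ t ℤ.- + chooseℤ (suc c) (+ k ℤ.+ (+ (3 + c) ℤ.- + 3)))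
               (cong (λ z → + (c * z)) (below k)) (cong (λ z → + (suc c * z)) middle))
  (trans (cong₂ ℤ._-_ (sym (ℤP.pos-+ (c * binomBelow (suc c) (k + 0)) _)) (cong +_ above)) refl)
  where
  below : ∀ k → chooseℤ (suc c) (+ k ℤ.- + 1) ≡ binomBelow (suc c) (k + 0)
  below zero    = refl
  below (suc k) = sym (trans (cong (binom (suc c)) (ℕP.+-identityʳ k)) (binom≡C (suc c) k))
  middle : chooseℤ (suc c) (+ k) ≡ binomBelow (suc c) (k + 1)
  middle = sym (trans (cong (binomBelow (suc c)) (ℕP.+-comm k 1)) (binom≡C (suc c) k))
  above : chooseℤ (suc c) (+ k ℤ.+ (+ (3 + c) ℤ.- + 3)) ≡ binomBelow (suc c) (k + suc c)
  above = sym (trans (cong (binomBelow (suc c)) (ℕP.+-suc k c)) (binom≡C (suc c) (k + c)))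

Cformula-sum : ∀ c d → sumTo d (λ k → Cformula (3 + c) k ℤ.* + (d C k)) ≡ + twoPeakBinomials c d ℤ.- + suc (c + d)
Cformula-sum c d = begin
  sumTo d (λ k → Cformula (3 + c) k ℤ.* + (d C k))
    ≡⟨ sumTo-cong d (λ k → cong₂ ℤ._*_ (Cformula-binomBelow c k) (cong +_ (sym (binom≡C d k)))) ⟩
  sumTo d (λ k → (+ f₊ k ℤ.- + f₋ k) ℤ.* + binom d k)
    ≡⟨ sumTo-difference d f₊ f₋ (binom d) ⟩
  + binomialSum d f₊ ℤ.- + binomialSum d f₋
    ≡⟨ cong₂ (λ s t → + s ℤ.- + t) positive negative ⟩
  + twoPeakBinomials c d ℤ.- + suc (c + d) ∎
  where
  open ≡-Reasoning
  a = suc c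
  f₊ f₋ : ℕ → ℕ
  f₊ k = c * binomBelow a (k + 0) + suc c * binomBelow a (k + 1)
  f₋ k = binomBelow a (k + suc c)
  sumTo-cong : ∀ t {F G : ℕ → ℤ} → (∀ k → F k ≡ G k) → sumTo t F ≡ sumTo t G
  sumTo-cong zero    e = e 0
  sumTo-cong (suc t) e = cong₂ ℤ._+_ (sumTo-cong t e) (e (suc t))
  binomialSum-scaled : ∀ x r u → r + u ≡ suc a →
    sumUpTo d (λ k → x * (binomBelow a (k + r) * binom d k)) ≡ x * binom (a + d) u
  binomialSum-scaled x r u e = trans (sumUpTo-* d x _) (cong (x *_) (vandermonde a d r u e))
  positive : binomialSum d f₊ ≡ twoPeakBinomials c d
  positive = trans (sumUpTo-cong d (λ k → ℕP.*-distribʳ-+ (binom d k) (c * binomBelow a (k + 0)) (suc c * binomBelow a (k + 1))))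
    (trans (sumUpTo-cong d (λ k → cong₂ _+_ (ℕP.*-assoc c (binomBelow a (k + 0)) (binom d k))
                                            (ℕP.*-assoc (suc c) (binomBelow a (k + 1)) (binom d k))))
    (trans (sumUpTo-+ d (λ k → c * (binomBelow a (k + 0) * binom d k)) (λ k → suc c * (binomBelow a (k + 1) * binom d k)))
           (cong₂ _+_ (binomialSum-scaled c 0 (suc a) refl) (binomialSum-scaled (suc c) 1 a refl))))
  negative : binomialSum d f₋ ≡ suc (c + d)
  negative = trans (vandermonde a d (suc c) 1 (cong suc (ℕP.+-comm c 1))) (binom-1 (a + d))

-- The closed form of twoPeaks, moved to ℤ where the subtraction is exact.
twoPeaks-ℤ : ∀ c d → + twoPeaks c d ≡ + (2 ^ (c + d)) ℤ.* (+ twoPeakBinomials c d ℤ.- + suc (c + d))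
twoPeaks-ℤ c d = begin
  + twoPeaks c d
    ≡⟨ add-sub (+ twoPeaks c d) (+ (p * s)) ⟩
  (+ twoPeaks c d ℤ.+ + (p * s)) ℤ.- + (p * s)
    ≡⟨ cong (λ z → z ℤ.- + (p * s)) (trans (sym (ℤP.pos-+ (twoPeaks c d) (p * s))) (cong +_ (twoPeaks-closed c d))) ⟩
  + (p * twoPeakBinomials c d) ℤ.- + (p * s)
    ≡⟨ cong₂ ℤ._-_ (ℤP.pos-* p _) (ℤP.pos-* p s) ⟩
  + p ℤ.* + twoPeakBinomials c d ℤ.- + p ℤ.* + s
    ≡⟨ factor (+ p) _ (+ s) ⟩
  + p ℤ.* (+ twoPeakBinomials c d ℤ.- + s) ∎
  where
  open ≡-Reasoning
  p = 2 ^ (c + d)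
  s = suc (c + d)
  add-sub : ∀ x y → x ≡ (x ℤ.+ y) ℤ.- y
  add-sub = ℤSolver.solve-∀
  factor : ∀ p x s → p ℤ.* x ℤ.- p ℤ.* s ≡ p ℤ.* (x ℤ.- s)
  factor = ℤSolver.solve-∀

flagAt-flat : ∀ c d q → flagAt (flat c ++ true ∷ flat d) q ≡ true ⇔ q ≡ c
flagAt-flat c d q = mk⇔ (to c q) (λ { refl → from c })
  where
  flat-unflagged : ∀ d q → flagAt (flat d) q ≢ true
  flat-unflagged (suc d) zero    ()
  flat-unflagged (suc d) (suc q) = flat-unflagged d q
  to : ∀ c q → flagAt (flat c ++ true ∷ flat d) q ≡ true → q ≡ c
  to zero    zero    _ = refl
  to zero    (suc q) e = ⊥-elim (flat-unflagged d q e)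
  to (suc c) (suc q) e = cong suc (to c q e)
  from : ∀ c → flagAt (flat c ++ true ∷ flat d) c ≡ true
  from zero    = refl
  from (suc c) = from c

twoPeakWord-flag : ∀ c d q → flagAt (twoPeakWord c d) q ≡ true ⇔ (q ≡ 1 ⊎ q ≡ 2 + c)
twoPeakWord-flag c d zero          = mk⇔ (λ ()) (λ { (inj₁ ()) ; (inj₂ ()) })
twoPeakWord-flag c d (suc zero)    = mk⇔ (λ _ → inj₁ refl) (λ _ → refl)
twoPeakWord-flag c d (suc (suc q)) = mk⇔
  (λ e → inj₂ (cong (_+_ 2) (Equivalence.to (flagAt-flat c d q) e)))
  (λ { (inj₁ ()) ; (inj₂ refl) → Equivalence.from (flagAt-flat c d q) refl })

length-twoPeakWord : ∀ c d → length (twoPeakWord c d) ≡ 3 + c + d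
length-twoPeakWord c d = cong (_+_ 2) (begin
  length (flat c ++ true ∷ flat d)     ≡⟨ ListP.length-++ (flat c) ⟩
  length (flat c) + suc (length (flat d)) ≡⟨ cong₂ (λ x y → x + suc y) (ListP.length-replicate c) (ListP.length-replicate d) ⟩
  c + suc d                             ≡⟨ ℕP.+-suc c d ⟩
  suc (c + d)                           ∎)
  where open ≡-Reasoning

length-peakWord : ∀ w → length (peakWord w) ≡ length w
length-peakWord []      = refl
length-peakWord (a ∷ r) = cong suc (length-peakFlags a r)
  where
  length-peakFlags : ∀ a r → length (peakFlags a r) ≡ length r
  length-peakFlags a []      = refl
  length-peakFlags a (b ∷ r) = cong suc (length-peakFlags b r)

flags-ext : ∀ X Y → length X ≡ length Y → (∀ q → flagAt X q ≡ true ⇔ flagAt Y q ≡ true) → X ≡ Y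
flags-ext []      []      _   _    = refl
flags-ext (x ∷ X) (y ∷ Y) len same =
  cong₂ _∷_ (head x y (same 0)) (flags-ext X Y (ℕP.suc-injective len) (same ∘ suc))
  where
  head : ∀ x y → x ≡ true ⇔ y ≡ true → x ≡ y
  head true  y     e = sym (Equivalence.to e refl)
  head false true  e = Equivalence.from e refl
  head false false _ = refl

peakPositions : ∀ c i → (i ∸ 1 ≡ 1 ⊎ i ∸ 1 ≡ 2 + c) ⇔ i ∈ 2 ∷ (3 + c) ∷ []
peakPositions c zero    = mk⇔ (λ { (inj₁ ()) ; (inj₂ ()) }) (λ { (here ()) ; (there (here ())) })
peakPositions c (suc i) = mk⇔ (λ { (inj₁ refl) → here refl ; (inj₂ refl) → there (here refl) })
                              (λ { (here refl) → inj₁ refl ; (there (here refl)) → inj₂ refl })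

hasPeakSet⇔peakWord : ∀ c d (v : Vec (Fin (3 + c + d)) (3 + c + d)) →
  HasPeakSet v (2 ∷ (3 + c) ∷ []) ⇔ (peakWord (wordOf v) ≡ twoPeakWord c d)
hasPeakSet⇔peakWord c d v = mk⇔ to from
  where
  characterise : ∀ i → flagAt (twoPeakWord c d) (i ∸ 1) ≡ true ⇔ i ∈ 2 ∷ (3 + c) ∷ []
  characterise i = ⇔.trans (twoPeakWord-flag c d (i ∸ 1)) (peakPositions c i)
  from : peakWord (wordOf v) ≡ twoPeakWord c d → HasPeakSet v (2 ∷ (3 + c) ∷ [])
  from e i = ⇔.trans (isPeak⇔flag v i) (subst (λ W → flagAt W (i ∸ 1) ≡ true ⇔ _) (sym e) (characterise i))
  to : HasPeakSet v (2 ∷ (3 + c) ∷ []) → peakWord (wordOf v) ≡ twoPeakWord c d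
  to peaks = flags-ext _ _
    (trans (length-peakWord (wordOf v)) (trans (length-wordOf v) (sym (length-twoPeakWord c d))))
    (λ q → ⇔.trans (⇔.sym (isPeak⇔flag v (suc q))) (⇔.trans (peaks (suc q)) (⇔.sym (characterise (suc q)))))

length-filter : {P : A → Set} (P? : ∀ x → Dec (P x)) (xs : List A) →
  length (filter P? xs) ≡ sumOver xs (λ x → indicator (does (P? x)))
length-filter P? []       = refl
length-filter P? (x ∷ xs) with does (P? x)
... | true  = cong suc (length-filter P? xs)
... | false = length-filter P? xs

-- P({2, c+3}; c+d+3) is enumerated by the permutation vectors whose peak word is twoPeakWord c d.
twoPeaks-card : ∀ c d → HasCard (InP (2 ∷ (3 + c) ∷ []) (3 + c + d)) (twoPeaks c d)
twoPeaks-card c d = filter has? (permVecs n) , Unique.filter⁺ has? (permVecs-unique n) , members , size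
  where
  n = 3 + c + d
  has? : ∀ v → Dec (peakWord (wordOf v) ≡ twoPeakWord c d)
  has? v = peakWord (wordOf v) ≟ʷ twoPeakWord c d
  members : ∀ v → v ∈ filter has? (permVecs n) ⇔ InP (2 ∷ (3 + c) ∷ []) n v
  members v = mk⇔
    (λ v∈ → let v∈′ , e = ∈-filter⁻ has? v∈ in permVecs-sound n v v∈′ , Equivalence.from (hasPeakSet⇔peakWord c d v) e)
    (λ (perm , peaks) → ∈-filter⁺ has? (permVecs-complete n v perm) (Equivalence.to (hasPeakSet⇔peakWord c d v) peaks))
  size : length (filter has? (permVecs n)) ≡ twoPeaks c d
  size = trans (length-filter has? (permVecs n))
         (trans (sym (sumOver-map wordOf (permVecs n) (λ w → indicator (does (peakWord w ≟ʷ twoPeakWord c d)))))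
                (cong (λ ws → sumOver ws (λ w → indicator (does (peakWord w ≟ʷ twoPeakWord c d)))) (map-wordOf-permVecs n)))

twoPeaks-expansion : ∀ c d → + twoPeaks c d ≡ + (2 ^ (c + d)) ℤ.* sumTo ((c + d) ∸ c) (λ k → Cformula (3 + c) k ℤ.* + (((c + d) ∸ c) C k))
twoPeaks-expansion c d =
  trans (twoPeaks-ℤ c d)
        (cong (λ t → + (2 ^ (c + d)) ℤ.* t)
              (subst (λ t → + twoPeakBinomials c d ℤ.- + suc (c + d) ≡ sumTo t (λ k → Cformula (3 + c) k ℤ.* + (t C k)))
                     (sym (ℕP.m+n∸m≡n c d)) (sym (Cformula-sum c d))))

binomBelow-big : ∀ a j → suc a < j → binomBelow a j ≡ 0
binomBelow-big a (suc j) (s≤s a<j) = binom-big a j a<j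

Cformula-finite : ∀ c k → 3 + c < k → Cformula (3 + c) k ≡ + 0
Cformula-finite c k m<k = trans (Cformula-binomBelow c k)
  (vanish (binomBelow-big a (k + 0) (beyond 0)) (binomBelow-big a (k + 1) (beyond 1)) (binomBelow-big a (k + suc c) (beyond (suc c))))
  where
  a = suc c
  beyond : ∀ r → suc a < k + r
  beyond r = ℕP.<-≤-trans (ℕP.<-trans (ℕP.n<1+n (suc a)) m<k) (ℕP.m≤m+n k r)
  vanish : ∀ {x y z} → x ≡ 0 → y ≡ 0 → z ≡ 0 → + (c * x + suc c * y) ℤ.- + z ≡ + 0
  vanish refl refl refl = cong₂ (λ s t → + (s + t) ℤ.- + 0) (ℕP.*-zeroʳ c) (ℕP.*-zeroʳ (suc c))

-- The coefficients are nonnegative: only for k ≤ 1 is the subtracted binomial nonzero.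
binom-suc-self : ∀ n → binom (suc n) n ≡ suc n
binom-suc-self zero    = refl
binom-suc-self (suc n) = trans (cong₂ _+_ (binom-suc-self n) (binom-diag (suc n))) (ℕP.+-comm (suc n) 1)

difference-nonneg : ∀ {x z} → z ≤ x → + 0 ≤ℤ + x ℤ.- + z
difference-nonneg {x} {z} z≤x = subst (+ 0 ≤ℤ_) (sym (trans (ℤP.m-n≡m⊖n x z) (ℤP.⊖-≥ z≤x))) (ℤ.+≤+ z≤n)

Cformula-nonneg : ∀ c k → + 0 ≤ℤ Cformula (3 + c) k
Cformula-nonneg c k = subst (+ 0 ≤ℤ_) (sym (Cformula-binomBelow c k)) (nonneg k)
  where
  a = suc c
  nonneg : ∀ k → + 0 ≤ℤ + (c * binomBelow a (k + 0) + suc c * binomBelow a (k + 1)) ℤ.- + binomBelow a (k + suc c)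
  nonneg zero          = difference-nonneg (ℕP.≤-reflexive (trans (binom-suc-self c) (sym (simplify c))))
    where
    simplify : ∀ c → c * 0 + suc c * 1 ≡ suc c
    simplify = solve-∀
  nonneg (suc zero)    = difference-nonneg (subst (_≤ c * 1 + suc c * binom a 1) (sym (binom-diag a))
                           (ℕP.≤-trans (s≤s z≤n) (ℕP.m≤n+m (suc c * binom a 1) (c * 1))))
  nonneg (suc (suc k)) =
    subst (λ z → + 0 ≤ℤ + (c * binomBelow a (suc (suc k) + 0) + suc c * binomBelow a (suc (suc k) + 1)) ℤ.- + z)
          (sym (binomBelow-big a (suc (suc k) + suc c) (s≤s (s≤s (ℕP.m≤n+m (suc c) k)))))
          (difference-nonneg z≤n)

proposition5p4 : (m : ℕ) → 4 ≤ m →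
    IsPeakCoeffs (2 ∷ m ∷ []) m (Cformula m) × (∀ (k : ℕ) → + 0 ≤ℤ Cformula m k)
proposition5p4 m@(suc (suc (suc c@(suc _)))) (s≤s (s≤s (s≤s (s≤s z≤n)))) = ((m , Cformula-finite c) , counts) , Cformula-nonneg c
  where
  Expansion : ℕ → Set
  Expansion n = ∃ λ N → HasCard (InP (2 ∷ m ∷ []) n) N ×
    (+ N ≡ + (2 ^ (n ∸ 2 ∸ 1)) ℤ.* sumTo (n ∸ m) (λ k → Cformula m k ℤ.* + ((n ∸ m) C k)))
  counts : ∀ n → m < n → Expansion n
  counts n m<n = subst Expansion (ℕP.m+[n∸m]≡n (ℕP.<⇒≤ m<n))
    (twoPeaks c (n ∸ m) , twoPeaks-card c (n ∸ m) , twoPeaks-expansion c (n ∸ m))
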